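{- Let $\mathcal{W}^{\le\ge}$ be the set of Dyck paths whose sequence of valley heights (read left to right) is weakly unimodal. For a Dyck path $D$ let $|D|$ be its semilength and $\mathrm{sp}'(D)$ the number of pairs of consecutive valleys of $D$ at the same height. Then $$\sum_{D\in\mathcal{W}^{\le\ge}}t^{\mathrm{sp}'(D)}z^{|D|}=\frac{1-(3+2t)z+(2+4t+t^2)z^2-(1+t+t^2)z^3}{(1-z)\big(1-(2t+3)z+(1+4t+t^2)z^2-t^2z^3\big)}.$$
   Context: A Dyck path of semilength $n$ is a lattice path with steps $\mathbf{u}=(1,1)$ and $\mathbf{d}=(1,-1)$ from $(0,0)$ to $(2n,0)$ never going below the $x$-axis. A valley is an occurrence of consecutive steps $\mathbf{du}$; its height is the $y$-coordinate of its lowest vertex. Two valleys are consecutive if no other valley lies between them. A sequence $a_1,\dots,a_k$ is weakly unimodal if there is $j$ with $a_1\le\dots\le a_j\ge a_{j+1}\ge\dots\ge a_k$; the empty sequence counts as unimodal. -}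

module Defs where

open import Data.Nat using (ℕ; zero; suc; _+_; _*_; _∸_; _≤_; _≤?_)
open import Data.Nat.Properties using (_≟_)
open import Data.Integer as ℤ using (ℤ; +_; -_)
open import Data.List using (List; []; _∷_; length; take; drop; foldr)
open import Data.List.Relation.Unary.Linked using (Linked)
open import Data.List.Relation.Unary.Unique.Propositional using (Unique)
open import Data.List.Membership.Propositional using (_∈_)
open import Data.Product using (Σ; _×_; _,_)
open import Function.Bundles using (_⇔_)
open import Relation.Binary.PropositionalEquality using (_≡_)
open import Relation.Nullary using (does)
open import Data.Bool using (if_then_else_; _∧_)

data Step : Set where
  U D : Step     -- U = (1,1), D = (1,-1)

-- DyckFrom h s : the word s, started at height h, never goes below the
-- x-axis and ends at height 0.
data DyckFrom : ℕ → List Step → Set where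
  done : DyckFrom 0 []
  up   : ∀ {h s} → DyckFrom (suc h) s → DyckFrom h (U ∷ s)
  down : ∀ {h s} → DyckFrom h s → DyckFrom (suc h) (D ∷ s)

IsDyck : List Step → Set
IsDyck = DyckFrom 0

-- Heights of the valleys (occurrences of D U), read left to right,
-- for a word started at height h.  The height of a valley is the height
-- of its lowest vertex, i.e. the height after the D step.
valleyHeightsFrom : ℕ → List Step → List ℕ
valleyHeightsFrom h []            = []
valleyHeightsFrom h (D ∷ U ∷ s)   = (h ∸ 1) ∷ valleyHeightsFrom (h ∸ 1) (U ∷ s)
valleyHeightsFrom h (D ∷ s)       = valleyHeightsFrom (h ∸ 1) s
valleyHeightsFrom h (U ∷ s)       = valleyHeightsFrom (suc h) s

valleyHeights : List Step → List ℕ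
valleyHeights = valleyHeightsFrom 0

equalAdjacent : List ℕ → ℕ
equalAdjacent []            = 0
equalAdjacent (x ∷ [])      = 0
equalAdjacent (x ∷ y ∷ r)   = (if does (x ≟ y) then 1 else 0) + equalAdjacent (y ∷ r)

sp′ : List Step → ℕ
sp′ w = equalAdjacent (valleyHeights w)

-- Weak unimodality: ∃ j, a₁ ≤ … ≤ aⱼ ≥ aⱼ₊₁ ≥ … ≥ a_k
-- (take j xs nondecreasing, drop (j-1) xs = aⱼ … a_k nonincreasing;
--  j = 0 is allowed and also covers the empty sequence)

WeaklyUnimodal : List ℕ → Set
WeaklyUnimodal xs =
  Σ ℕ λ j → Linked _≤_ (take j xs) × Linked (λ a b → b ≤ a) (drop (j ∸ 1) xs)

Counted : ℕ → ℕ → List Step → Set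
Counted n k w =
  length w ≡ 2 * n × IsDyck w × WeaklyUnimodal (valleyHeights w) × sp′ w ≡ k

HasCard : (List Step → Set) → ℕ → Set
HasCard P m =
  Σ (List (List Step)) λ ws → Unique ws × ((w : List Step) → (w ∈ ws) ⇔ P w) × length ws ≡ m

-- Formal power series in t, z over ℤ: f n k = coefficient of t^k z^n.
-- Polynomials: lists of terms (c , i , j) meaning c · t^i · z^j.

Series : Set
Series = ℕ → ℕ → ℤ

Term : Set
Term = ℤ × ℕ × ℕ

Poly : Set
Poly = List Term

coeffPoly : Poly → Series
coeffPoly []                  n k = + 0
coeffPoly ((c , i , j) ∷ ps)  n k =
  (if does (i ≟ k) ∧ does (j ≟ n) then c else + 0) ℤ.+ coeffPoly ps n k

mulPoly : Poly → Series → Series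
mulPoly []                  f n k = + 0
mulPoly ((c , i , j) ∷ ps)  f n k =
  (if does (j ≤? n) ∧ does (i ≤? k) then c ℤ.* f (n ∸ j) (k ∸ i) else + 0)
  ℤ.+ mulPoly ps f n k

numer : Poly
numer = (+ 1 , 0 , 0) ∷ (- + 3 , 0 , 1) ∷ (- + 2 , 1 , 1)
      ∷ (+ 2 , 0 , 2) ∷ (+ 4 , 1 , 2) ∷ (+ 1 , 2 , 2)
      ∷ (- + 1 , 0 , 3) ∷ (- + 1 , 1 , 3) ∷ (- + 1 , 2 , 3) ∷ []

denom₁ : Poly
denom₁ = (+ 1 , 0 , 0) ∷ (- + 1 , 0 , 1) ∷ []

denom₂ : Poly
denom₂ = (+ 1 , 0 , 0) ∷ (- + 3 , 0 , 1) ∷ (- + 2 , 1 , 1)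
       ∷ (+ 1 , 0 , 2) ∷ (+ 4 , 1 , 2) ∷ (+ 1 , 2 , 2)
       ∷ (- + 1 , 2 , 3) ∷ []

-- A nonempty Dyck path is U x D y, and its valley heights are those of x raised by one, followed,
-- if y is nonempty, by a valley at height 0 and those of y. Hence if x has valleys, unimodality
-- forces every valley of y to height 0, so y is a sequence of pyramids; if x is a pyramid, only y
-- matters. Sorting paths by whether x has valleys and whether y is empty, four operations (growing
-- the first pyramid, prefixing U D, raising x to U x D, inserting U D after the first return) give
-- a linear system of recurrences in the semilength for the five classes, with t recording new pairs
-- of equal consecutive valleys. The counts are realised by explicit duplicate-free enumerations,
-- and a ℤ[t,z]-combination of the recurrences, checked coefficientwise, yields
-- (1 - z)·denom₂·A = numer.

module Submission where

open import Defs
open import Data.Nat using (ℕ)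
open import Data.Product using (Σ; _×_; _,_)
open import Relation.Binary.PropositionalEquality using (_≡_)

module Counting where

  open import Data.Nat using (ℕ; zero; suc; _+_; _*_; _∸_; _≤_; _≥_; z≤n; s≤s)
  open import Data.Nat.Properties using (+-identityʳ; +-suc; +-assoc; suc-injective; _≟_)
  open import Data.Bool using (if_then_else_)
  open import Data.List using (List; []; _∷_; _++_; map; drop; take; length)
  open import Data.List.Properties
    using (++-assoc; ++-identityʳ; map-++; map-∘; map-cong; ++-cancelʳ; ∷-injectiveʳ; ++-conicalʳ; length-++; length-++-sucʳ; length-map)
  open import Data.List.Membership.Propositional using (_∈_)
  open import Data.List.Membership.Propositional.Properties using (∈-map⁺; ∈-map⁻; ∈-++⁺ˡ; ∈-++⁺ʳ; ∈-++⁻)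
  open import Data.List.Relation.Unary.Any using (here)
  open import Data.List.Relation.Unary.All as All using (All; []; _∷_)
  import Data.List.Relation.Unary.All.Properties as All
  open import Data.List.Relation.Unary.Linked using (Linked; []; [-]; _∷_)
  open import Data.List.Relation.Unary.Unique.Propositional using (Unique; []; _∷_)
  import Data.List.Relation.Unary.Unique.Propositional.Properties as Unique
  open import Data.Product using (Σ-syntax; proj₁; proj₂; map₁)
  open import Data.Sum using (_⊎_; inj₁; inj₂)
  open import Data.Empty using (⊥; ⊥-elim)
  open import Function using (_∘_; case_of_)
  open import Function.Bundles using (_⇔_; mk⇔; module Equivalence)
  import Function.Properties.Equivalence as ⇔
  open import Relation.Binary.PropositionalEquality
  open import Relation.Nullary using (¬_; does)

  private
    variable
      A B : Set
      m m′ : ℕ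

  data Dyck : List Step → Set where
    nil  : Dyck []
    cons : ∀ {x y} → Dyck x → Dyck y → Dyck (U ∷ x ++ D ∷ y)

  Dyck-prefix : ∀ {x c s} → Dyck x → DyckFrom c s → DyckFrom c (x ++ s)
  Dyck-prefix nil p = p
  Dyck-prefix {s = s} (cons {x} {y} dx dy) p
    rewrite ++-assoc x (D ∷ y) s = up (Dyck-prefix dx (down (Dyck-prefix dy p)))

  Dyck⇒IsDyck : ∀ {w} → Dyck w → IsDyck w
  Dyck⇒IsDyck {w} d = subst IsDyck (++-identityʳ w) (Dyck-prefix d done)

  data Descent : ℕ → List Step → Set where
    returned : ∀ {w} → Dyck w → Descent 0 w
    descend  : ∀ {c x w} → Dyck x → Descent c w → Descent (suc c) (x ++ D ∷ w)

  Descent-up : ∀ {c s} → Descent (suc c) s → Descent c (U ∷ s)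
  Descent-up (descend dx (returned dw)) = returned (cons dx dw)
  Descent-up (descend {x = x} dx (descend {x = x′} {w} dx′ r)) =
    subst (Descent _) (cong (U ∷_) (++-assoc x (D ∷ x′) (D ∷ w))) (descend (cons dx dx′) r)

  DyckFrom⇒Descent : ∀ {c s} → DyckFrom c s → Descent c s
  DyckFrom⇒Descent done     = returned nil
  DyckFrom⇒Descent (up p)   = Descent-up (DyckFrom⇒Descent p)
  DyckFrom⇒Descent (down p) = descend nil (DyckFrom⇒Descent p)

  IsDyck⇒Dyck : ∀ {w} → IsDyck w → Dyck w
  IsDyck⇒Dyck p with DyckFrom⇒Descent p
  ... | returned d = d

  firstReturn : ℕ → List Step → List Step × List Step
  firstReturn h       []      = [] , []
  firstReturn h       (U ∷ s) = map₁ (U ∷_) (firstReturn (suc h) s)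
  firstReturn zero    (D ∷ s) = [] , s
  firstReturn (suc h) (D ∷ s) = map₁ (D ∷_) (firstReturn h s)

  firstReturn-Dyck : ∀ {x} → Dyck x → ∀ h s → firstReturn h (x ++ s) ≡ map₁ (x ++_) (firstReturn h s)
  firstReturn-Dyck nil h s = refl
  firstReturn-Dyck (cons {x} {y} dx dy) h s
    rewrite ++-assoc x (D ∷ y) s | firstReturn-Dyck dx (suc h) (D ∷ y ++ s) | firstReturn-Dyck dy h s
    = cong (λ r → U ∷ r , proj₂ (firstReturn h s)) (sym (++-assoc x (D ∷ y) _))

  firstReturn-cons : ∀ {x} → Dyck x → ∀ y → firstReturn 0 (x ++ D ∷ y) ≡ (x , y)
  firstReturn-cons {x} dx y rewrite firstReturn-Dyck dx 0 (D ∷ y) | ++-identityʳ x = refl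

  cons-injective : ∀ {x y x′ y′} → Dyck x → Dyck x′ →
    U ∷ x ++ D ∷ y ≡ U ∷ x′ ++ D ∷ y′ → x ≡ x′ × y ≡ y′
  cons-injective {x} {y} {x′} {y′} dx dx′ e = cong proj₁ split , cong proj₂ split
    where
    split : (x , y) ≡ (x′ , y′)
    split = trans (sym (firstReturn-cons dx y))
              (trans (cong (firstReturn 0 ∘ drop 1) e) (firstReturn-cons dx′ y′))

  Dyck-cons⁻ : ∀ {x y} → Dyck x → Dyck (U ∷ x ++ D ∷ y) → Dyck y
  Dyck-cons⁻ dx d = go dx d refl
    where
    go : ∀ {x y w} → Dyck x → Dyck w → w ≡ U ∷ x ++ D ∷ y → Dyck y
    go dx (cons dx′ dy′) e = subst Dyck (proj₂ (cons-injective dx′ dx e)) dy′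

  returnValleys : List Step → List ℕ
  returnValleys []      = []
  returnValleys (s ∷ r) = 0 ∷ valleyHeights (s ∷ r)

  returnValleys-Dyck : ∀ {y} → Dyck y → valleyHeightsFrom 1 (D ∷ y) ≡ returnValleys y
  returnValleys-Dyck nil        = refl
  returnValleys-Dyck (cons _ _) = refl

  mutual
    valleyHeights-prefix : ∀ {x} → Dyck x → ∀ h s →
      valleyHeightsFrom h (x ++ D ∷ s) ≡ map (h +_) (valleyHeights x) ++ valleyHeightsFrom h (D ∷ s)
    valleyHeights-prefix nil h s = refl
    valleyHeights-prefix (cons {x} {y} dx dy) h s = begin
      valleyHeightsFrom (suc h) ((x ++ D ∷ y) ++ D ∷ s)
        ≡⟨ cong (valleyHeightsFrom (suc h)) (++-assoc x (D ∷ y) (D ∷ s)) ⟩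
      valleyHeightsFrom (suc h) (x ++ D ∷ y ++ D ∷ s)
        ≡⟨ valleyHeights-prefix dx (suc h) (y ++ D ∷ s) ⟩
      map (suc h +_) (valleyHeights x) ++ valleyHeightsFrom (suc h) (D ∷ y ++ D ∷ s)
        ≡⟨ cong₂ _++_ (shift-map (valleyHeights x)) (valleyHeights-return dy h s) ⟩
      map (h +_) (map suc (valleyHeights x)) ++ map (h +_) (returnValleys y) ++ rest
        ≡⟨ sym (++-assoc (map (h +_) (map suc (valleyHeights x))) _ rest) ⟩
      (map (h +_) (map suc (valleyHeights x)) ++ map (h +_) (returnValleys y)) ++ rest
        ≡⟨ cong (_++ rest) (sym (map-++ (h +_) (map suc (valleyHeights x)) (returnValleys y))) ⟩
      map (h +_) (map suc (valleyHeights x) ++ returnValleys y) ++ rest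
        ≡⟨ cong (λ v → map (h +_) v ++ rest) (sym (valleyHeights-cons dx dy)) ⟩
      map (h +_) (valleyHeights (U ∷ x ++ D ∷ y)) ++ rest ∎
      where
      open ≡-Reasoning
      rest : List ℕ
      rest = valleyHeightsFrom h (D ∷ s)
      shift-map : ∀ vs → map (suc h +_) vs ≡ map (h +_) (map suc vs)
      shift-map vs = trans (map-cong (λ v → sym (+-suc h v)) vs) (map-∘ vs)

    valleyHeights-return : ∀ {y} → Dyck y → ∀ h s →
      valleyHeightsFrom (suc h) (D ∷ y ++ D ∷ s) ≡ map (h +_) (returnValleys y) ++ valleyHeightsFrom h (D ∷ s)
    valleyHeights-return nil h s = refl
    valleyHeights-return d@(cons _ _) h s =
      cong₂ _∷_ (sym (+-identityʳ h)) (valleyHeights-prefix d h s)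

    valleyHeights-cons : ∀ {x y} → Dyck x → Dyck y →
      valleyHeights (U ∷ x ++ D ∷ y) ≡ map suc (valleyHeights x) ++ returnValleys y
    valleyHeights-cons {x} dx dy =
      trans (valleyHeights-prefix dx 1 _) (cong (map suc (valleyHeights x) ++_) (returnValleys-Dyck dy))

  pyramid : ℕ → List Step
  pyramid zero    = []
  pyramid (suc m) = U ∷ pyramid m ++ D ∷ []

  Dyck-pyramid : ∀ m → Dyck (pyramid m)
  Dyck-pyramid zero    = nil
  Dyck-pyramid (suc m) = cons (Dyck-pyramid m) nil

  valleyHeights-pyramid : ∀ m → valleyHeights (pyramid m) ≡ []
  valleyHeights-pyramid zero = refl
  valleyHeights-pyramid (suc m)
    rewrite valleyHeights-cons (Dyck-pyramid m) nil | valleyHeights-pyramid m = refl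

  pyramid-injective : ∀ {m m′} → pyramid m ≡ pyramid m′ → m ≡ m′
  pyramid-injective {zero}  {zero}   _ = refl
  pyramid-injective {suc m} {suc m′} e =
    cong suc (pyramid-injective (++-cancelʳ (D ∷ []) (pyramid m) (pyramid m′) (∷-injectiveʳ e)))

  valleyless⇒pyramid : ∀ {x} → Dyck x → valleyHeights x ≡ [] → Σ ℕ λ m → x ≡ pyramid m
  valleyless⇒pyramid nil _ = 0 , refl
  valleyless⇒pyramid (cons {x} dx nil) e
    with valleyHeights x in vx | trans (sym (valleyHeights-cons dx nil)) e
  ... | []    | _ = let m , x≡ = valleyless⇒pyramid dx vx in suc m , cong (λ x → U ∷ x ++ D ∷ []) x≡
  ... | _ ∷ _ | ()
  valleyless⇒pyramid (cons {x} dx (cons dx′ dy′)) e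
    with ++-conicalʳ (map suc (valleyHeights x)) _ (trans (sym (valleyHeights-cons dx (cons dx′ dy′))) e)
  ... | ()

  -- hill j y = pyramid (suc j) ++ y.
  hill : ℕ → List Step → List Step
  hill j y = U ∷ pyramid j ++ D ∷ y

  hill-injective : ∀ {j j′ y y′} → hill j y ≡ hill j′ y′ → j ≡ j′ × y ≡ y′
  hill-injective {j} {j′} e with cons-injective (Dyck-pyramid j) (Dyck-pyramid j′) e
  ... | pyr , tail = pyramid-injective pyr , tail

  Dyck-hill⇔ : ∀ j {y} → Dyck (hill j y) ⇔ Dyck y
  Dyck-hill⇔ j = mk⇔ (Dyck-cons⁻ (Dyck-pyramid j)) (cons (Dyck-pyramid j))

  valleyHeights-hill : ∀ j {y} → Dyck y → valleyHeights (hill j y) ≡ returnValleys y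
  valleyHeights-hill j dy
    rewrite valleyHeights-cons (Dyck-pyramid j) dy | valleyHeights-pyramid j = refl

  length-hill-suc : ∀ j y → length (hill (suc j) y) ≡ 2 + length (hill j y)
  length-hill-suc j y =
    cong suc (trans (cong length (++-assoc (U ∷ pyramid j) (D ∷ []) (D ∷ y)))
                    (cong suc (length-++-sucʳ (pyramid j) D (D ∷ y))))

  data Unimodal : List ℕ → Set where
    nonincreasing : ∀ {xs} → Linked _≥_ xs → Unimodal xs
    ascend        : ∀ {x y r} → x ≤ y → Unimodal (y ∷ r) → Unimodal (x ∷ y ∷ r)

  Unimodal⇒WeaklyUnimodal : ∀ {xs} → Unimodal xs → WeaklyUnimodal xs
  Unimodal⇒WeaklyUnimodal (nonincreasing d) = 0 , [] , d
  Unimodal⇒WeaklyUnimodal (ascend x≤y u) with Unimodal⇒WeaklyUnimodal u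
  ... | zero  , _  , dec = 2 , x≤y ∷ [-] , dec
  ... | suc j , inc , dec = suc (suc j) , x≤y ∷ inc , dec

  WeaklyUnimodal⇒Unimodal : ∀ {xs} → WeaklyUnimodal xs → Unimodal xs
  WeaklyUnimodal⇒Unimodal {xs} (j , inc , dec) = go xs j inc dec
    where
    go : ∀ xs j → Linked _≤_ (take j xs) → Linked _≥_ (drop (j ∸ 1) xs) → Unimodal xs
    go []          _             _           _   = nonincreasing []
    go _           zero          _           dec = nonincreasing dec
    go (_ ∷ [])    (suc _)       _           _   = nonincreasing [-]
    go (_ ∷ _ ∷ _) (suc zero)    _           dec = nonincreasing dec
    go (_ ∷ y ∷ r) (suc (suc j)) (x≤y ∷ inc) dec = ascend x≤y (go (y ∷ r) (suc j) inc dec)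

  Zeros : List ℕ → Set
  Zeros = All (_≡ 0)

  Linked-map-suc⇔ : ∀ {vs} → Linked _≥_ (map suc vs) ⇔ Linked _≥_ vs
  Linked-map-suc⇔ = mk⇔ to from
    where
    to : ∀ {vs} → Linked _≥_ (map suc vs) → Linked _≥_ vs
    to {[]}        _               = []
    to {_ ∷ []}    _               = [-]
    to {_ ∷ _ ∷ _} (s≤s le ∷ rest) = le ∷ to rest
    from : ∀ {vs} → Linked _≥_ vs → Linked _≥_ (map suc vs)
    from []          = []
    from [-]         = [-]
    from (le ∷ rest) = s≤s le ∷ from rest

  Unimodal-map-suc⇔ : ∀ {vs} → Unimodal (map suc vs) ⇔ Unimodal vs
  Unimodal-map-suc⇔ = mk⇔ to from
    where
    to : ∀ {vs} → Unimodal (map suc vs) → Unimodal vs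
    to {[]}        _                   = nonincreasing []
    to {_ ∷ []}    _                   = nonincreasing [-]
    to {_ ∷ _ ∷ _} (nonincreasing d)   = nonincreasing (Equivalence.to Linked-map-suc⇔ d)
    to {_ ∷ _ ∷ _} (ascend (s≤s le) u) = ascend le (to u)
    from : ∀ {vs} → Unimodal vs → Unimodal (map suc vs)
    from (nonincreasing d) = nonincreasing (Equivalence.from Linked-map-suc⇔ d)
    from (ascend le u)     = ascend (s≤s le) (from u)

  Linked-zero⇔ : ∀ {vs} → Linked _≥_ (0 ∷ vs) ⇔ Zeros vs
  Linked-zero⇔ = mk⇔ to from
    where
    to : ∀ {vs} → Linked _≥_ (0 ∷ vs) → Zeros vs
    to [-]           = []
    to (z≤n ∷ rest)  = refl ∷ to rest
    from : ∀ {vs} → Zeros vs → Linked _≥_ (0 ∷ vs)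
    from []          = [-]
    from (refl ∷ zs) = z≤n ∷ from zs

  Linked-valley⇔ : ∀ us {vs} → Linked _≥_ (map suc us ++ 0 ∷ vs) ⇔ (Linked _≥_ us × Zeros vs)
  Linked-valley⇔ us = mk⇔ (to us) from
    where
    to : ∀ us {vs} → Linked _≥_ (map suc us ++ 0 ∷ vs) → Linked _≥_ us × Zeros vs
    to []           d                 = [] , Equivalence.to Linked-zero⇔ d
    to (_ ∷ [])     (_ ∷ d)           = [-] , Equivalence.to Linked-zero⇔ d
    to (_ ∷ _ ∷ us) (s≤s le ∷ d) with to (_ ∷ us) d
    ... | dus , zs = le ∷ dus , zs
    from : ∀ {us vs} → Linked _≥_ us × Zeros vs → Linked _≥_ (map suc us ++ 0 ∷ vs)
    from ([]        , zs) = Equivalence.from Linked-zero⇔ zs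
    from ([-]       , zs) = z≤n ∷ Equivalence.from Linked-zero⇔ zs
    from (le ∷ dus  , zs) = s≤s le ∷ from (dus , zs)

  Unimodal-zero∷⇔ : ∀ {vs} → Unimodal (0 ∷ vs) ⇔ Unimodal vs
  Unimodal-zero∷⇔ = mk⇔ to from
    where
    to : ∀ {vs} → Unimodal (0 ∷ vs) → Unimodal vs
    to (nonincreasing [-])     = nonincreasing []
    to (nonincreasing (_ ∷ d)) = nonincreasing d
    to (ascend _ u)            = u
    from : ∀ {vs} → Unimodal vs → Unimodal (0 ∷ vs)
    from {[]}    _ = nonincreasing [-]
    from {_ ∷ _} u = ascend z≤n u

  Unimodal-valley⇔ : ∀ us {vs} → ¬ us ≡ [] → Unimodal (map suc us ++ 0 ∷ vs) ⇔ (Unimodal us × Zeros vs)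
  Unimodal-valley⇔ us us≢[] = mk⇔ (to us us≢[]) from
    where
    to : ∀ us {vs} → ¬ us ≡ [] → Unimodal (map suc us ++ 0 ∷ vs) → Unimodal us × Zeros vs
    to [] us≢[] _ = ⊥-elim (us≢[] refl)
    to (_ ∷ [])     _ (ascend () _)
    to (_ ∷ _ ∷ us) _ (ascend (s≤s le) u) with to (_ ∷ us) (λ ()) u
    ... | uus , zs = ascend le uus , zs
    to us@(_ ∷ _) _ (nonincreasing d) with Equivalence.to (Linked-valley⇔ us) d
    ... | dus , zs = nonincreasing dus , zs
    from : ∀ {us vs} → Unimodal us × Zeros vs → Unimodal (map suc us ++ 0 ∷ vs)
    from (nonincreasing d , zs) = nonincreasing (Equivalence.from (Linked-valley⇔ _) (d , zs))
    from (ascend le u     , zs) = ascend (s≤s le) (from (u , zs))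

  equalAdjacent-map-suc : ∀ vs → equalAdjacent (map suc vs) ≡ equalAdjacent vs
  equalAdjacent-map-suc []          = refl
  equalAdjacent-map-suc (_ ∷ [])    = refl
  equalAdjacent-map-suc (_ ∷ v ∷ vs) = cong (_ +_) (equalAdjacent-map-suc (v ∷ vs))

  equalAdjacent-valley : ∀ us vs →
    equalAdjacent (map suc us ++ 0 ∷ vs) ≡ equalAdjacent us + equalAdjacent (0 ∷ vs)
  equalAdjacent-valley []           vs = refl
  equalAdjacent-valley (_ ∷ [])     vs = refl
  equalAdjacent-valley (u ∷ v ∷ us) vs =
    trans (cong (_ +_) (equalAdjacent-valley (v ∷ us) vs)) (sym (+-assoc (if does (u ≟ v) then 1 else 0) (equalAdjacent (v ∷ us)) _))

  -- Defs.HasCard is the case A = List Step.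
  Enumerates : (A → Set) → ℕ → Set
  Enumerates {A} P m = Σ (List A) λ xs → Unique xs × (∀ x → x ∈ xs ⇔ P x) × length xs ≡ m

  enum-⇔ : {P Q : A → Set} → (∀ x → P x ⇔ Q x) → Enumerates P m → Enumerates Q m
  enum-⇔ P⇔Q (xs , u , mem , l) =
    xs , u , (λ x → mk⇔ (Equivalence.to (P⇔Q x) ∘ Equivalence.to (mem x))
                        (Equivalence.from (mem x) ∘ Equivalence.from (P⇔Q x))) , l

  enum-∅ : {P : A → Set} → (∀ x → ¬ P x) → Enumerates P 0
  enum-∅ ¬P = [] , [] , (λ x → mk⇔ (λ ()) (⊥-elim ∘ ¬P x)) , refl

  enum-singleton : {P : A → Set} (a : A) → (∀ x → a ≡ x ⇔ P x) → Enumerates P 1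
  enum-singleton a a≡⇔P =
    a ∷ [] , [] ∷ [] ,
    (λ x → mk⇔ (λ { (here refl) → Equivalence.to (a≡⇔P x) refl })
               (λ p → here (sym (Equivalence.from (a≡⇔P x) p)))) , refl

  enum-⊎ : {P Q : A → Set} → (∀ {x} → P x → Q x → ⊥) →
    Enumerates P m → Enumerates Q m′ → Enumerates (λ x → P x ⊎ Q x) (m + m′)
  enum-⊎ {P = P} {Q} disjoint (xs , ux , memx , lx) (ys , uy , memy , ly) =
    xs ++ ys ,
    Unique.++⁺ ux uy (λ (x∈xs , x∈ys) → disjoint (Equivalence.to (memx _) x∈xs) (Equivalence.to (memy _) x∈ys)) ,
    (λ x → mk⇔ (λ x∈ → split (∈-++⁻ xs x∈))
               (λ { (inj₁ p) → ∈-++⁺ˡ (Equivalence.from (memx x) p)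
                  ; (inj₂ q) → ∈-++⁺ʳ xs (Equivalence.from (memy x) q) })) ,
    trans (length-++ xs) (cong₂ _+_ lx ly)
    where
    split : ∀ {x} → x ∈ xs ⊎ x ∈ ys → P x ⊎ Q x
    split (inj₁ x∈xs) = inj₁ (Equivalence.to (memx _) x∈xs)
    split (inj₂ x∈ys) = inj₂ (Equivalence.to (memy _) x∈ys)

  Image : (A → B) → (A → Set) → B → Set
  Image {A} f P b = Σ A λ a → P a × f a ≡ b

  Image⇔ : {P : A → Set} {Q : B → Set} (f : A → B) → (∀ {a} → P a → Q (f a)) →
    (∀ {b} → Q b → Image f P b) → ∀ b → Image f P b ⇔ Q b
  Image⇔ f P⇒Q Q⇒Image b = mk⇔ (λ { (_ , p , refl) → P⇒Q p }) Q⇒Image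

  Unique-map⁺ : {P : A → Set} {xs : List A} (f : A → B) →
    (∀ {a a′} → P a → P a′ → f a ≡ f a′ → a ≡ a′) → All P xs → Unique xs → Unique (map f xs)
  Unique-map⁺ f inj []         []         = []
  Unique-map⁺ f inj (pa ∷ pas) (a∉ ∷ u) =
    All.map⁺ (All.zipWith (λ (a≢ , pa′) → a≢ ∘ inj pa pa′) (a∉ , pas)) ∷ Unique-map⁺ f inj pas u

  enum-image : {P : A → Set} (f : A → B) → (∀ {a a′} → P a → P a′ → f a ≡ f a′ → a ≡ a′) →
    Enumerates P m → Enumerates (Image f P) m
  enum-image f f-injective (xs , u , mem , l) =
    map f xs , Unique-map⁺ f f-injective (All.tabulate (Equivalence.to (mem _))) u ,
    (λ b → mk⇔ (λ b∈ → let a , a∈ , b≡ = ∈-map⁻ f b∈ in a , Equivalence.to (mem a) a∈ , sym b≡)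
               (λ { (a , p , refl) → ∈-map⁺ f (Equivalence.from (mem a) p) })) ,
    trans (length-map f xs) l

  Below : (ℕ → A → Set) → ℕ → A → Set
  Below P k a = Σ[ k′ ∈ ℕ ] k ≡ suc k′ × P k′ a

  below : (ℕ → ℕ) → ℕ → ℕ
  below f zero    = 0
  below f (suc k) = f k

  enum-Below : {P : ℕ → A → Set} {f : ℕ → ℕ} → (∀ k → Enumerates (P k) (f k)) → ∀ k → Enumerates (Below P k) (below f k)
  enum-Below enum zero    = enum-∅ λ { _ (_ , () , _) }
  enum-Below enum (suc k) = enum-⇔ (λ a → mk⇔ (λ p → k , refl , p) λ { (_ , refl , p) → p }) (enum k)

  enum-ℕ× : {R : ℕ × A → Set} → Enumerates (λ a → R (0 , a)) m → Enumerates (R ∘ map₁ suc) m′ → Enumerates R (m + m′)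
  enum-ℕ× {R = R} zeros sucs =
    enum-⇔ split
      (enum-⊎ (λ { (_ , _ , refl) (_ , _ , ()) })
              (enum-image (0 ,_) (λ _ _ → cong λ (_ , a) → a) zeros)
              (enum-image (map₁ suc) (λ { _ _ refl → refl }) sucs))
    where
    split : ∀ p → (Image (0 ,_) (λ a → R (0 , a)) p ⊎ Image (map₁ suc) (R ∘ map₁ suc) p) ⇔ R p
    split (j , a) = mk⇔ (λ { (inj₁ (_ , r , refl)) → r ; (inj₂ (_ , r , refl)) → r })
                        (byFirst j)
      where
      byFirst : ∀ j → R (j , a) → Image (0 ,_) (λ a → R (0 , a)) (j , a) ⊎ Image (map₁ suc) (R ∘ map₁ suc) (j , a)
      byFirst zero    r = inj₁ (a , r , refl)
      byFirst (suc j) r = inj₂ ((j , a) , r , refl)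

  -- For a nonempty path U x D y: pyramidal if x has no valleys (so U x D is a pyramid) and y = [],
  -- elevated if x has valleys and y = []; the ⁺ variants are those with y nonempty.
  data Shape : Set where
    empty pyramidal pyramidal⁺ elevated elevated⁺ : Shape

  shapeFrom : List ℕ → List Step → Shape
  shapeFrom []      []      = pyramidal
  shapeFrom []      (_ ∷ _) = pyramidal⁺
  shapeFrom (_ ∷ _) []      = elevated
  shapeFrom (_ ∷ _) (_ ∷ _) = elevated⁺

  shape : List Step → Shape
  shape (U ∷ s) = shapeFrom (valleyHeights (proj₁ (firstReturn 0 s))) (proj₂ (firstReturn 0 s))
  shape _       = empty

  shape-cons : ∀ {x} → Dyck x → ∀ y → shape (U ∷ x ++ D ∷ y) ≡ shapeFrom (valleyHeights x) y
  shape-cons dx y rewrite firstReturn-cons dx y = refl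

  shapeFrom-cons : ∀ vs {s s′ r r′} → shapeFrom vs (s ∷ r) ≡ shapeFrom vs (s′ ∷ r′)
  shapeFrom-cons []      = refl
  shapeFrom-cons (_ ∷ _) = refl

  shapeFrom≢empty : ∀ vs y → ¬ shapeFrom vs y ≡ empty
  shapeFrom≢empty []      []      ()
  shapeFrom≢empty []      (_ ∷ _) ()
  shapeFrom≢empty (_ ∷ _) []      ()
  shapeFrom≢empty (_ ∷ _) (_ ∷ _) ()

  shapeFrom-pyramidal : ∀ vs y → shapeFrom vs y ≡ pyramidal → vs ≡ [] × y ≡ []
  shapeFrom-pyramidal []      []      _ = refl , refl
  shapeFrom-pyramidal []      (_ ∷ _) ()
  shapeFrom-pyramidal (_ ∷ _) []      ()
  shapeFrom-pyramidal (_ ∷ _) (_ ∷ _) ()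

  shapeFrom-pyramidal⁺ : ∀ vs {y} → shapeFrom vs y ≡ pyramidal⁺ → vs ≡ []
  shapeFrom-pyramidal⁺ []      _ = refl
  shapeFrom-pyramidal⁺ (_ ∷ _) {[]}    ()
  shapeFrom-pyramidal⁺ (_ ∷ _) {_ ∷ _} ()

  shapeFrom-elevated : ∀ vs y → shapeFrom vs y ≡ elevated → y ≡ []
  shapeFrom-elevated (_ ∷ _) []      _ = refl
  shapeFrom-elevated []      []      ()
  shapeFrom-elevated []      (_ ∷ _) ()
  shapeFrom-elevated (_ ∷ _) (_ ∷ _) ()

  shapeFrom-elevated⁺ : ∀ vs y → shapeFrom vs y ≡ elevated⁺ → ¬ vs ≡ [] × ¬ y ≡ []
  shapeFrom-elevated⁺ (_ ∷ _) (_ ∷ _) _ = (λ ()) , (λ ())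
  shapeFrom-elevated⁺ []      []      ()
  shapeFrom-elevated⁺ []      (_ ∷ _) ()
  shapeFrom-elevated⁺ (_ ∷ _) []      ()

  shape-empty : ∀ {y} → Dyck y → shape y ≡ empty → y ≡ []
  shape-empty nil                 _ = refl
  shape-empty (cons {x} {y} dx _) e = ⊥-elim (shapeFrom≢empty (valleyHeights x) y (trans (sym (shape-cons dx y)) e))

  shape-hill : ∀ j y → shape (hill j y) ≡ shapeFrom [] y
  shape-hill j y rewrite shape-cons (Dyck-pyramid j) y | valleyHeights-pyramid j = refl

  raisedShape : Shape → Shape
  raisedShape empty     = pyramidal
  raisedShape pyramidal = pyramidal
  raisedShape _         = elevated

  shape-raise : ∀ {x} → Dyck x → shape (U ∷ x ++ D ∷ []) ≡ raisedShape (shape x)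
  shape-raise nil = refl
  shape-raise d@(cons {x} {y} dx dy)
    rewrite shape-cons d [] | valleyHeights-cons dx dy | shape-cons dx y with valleyHeights x | dy
  ... | []    | nil      = refl
  ... | []    | cons _ _ = refl
  ... | _ ∷ _ | nil      = refl
  ... | _ ∷ _ | cons _ _ = refl

  UD-shape : ∀ {y c} → shape y ≡ c → ¬ c ≡ empty → shape (U ∷ D ∷ y) ≡ pyramidal⁺
  UD-shape {[]}    refl c≢empty = ⊥-elim (c≢empty refl)
  UD-shape {_ ∷ _} _    _       = refl

  elevatedWith : List Step → Shape
  elevatedWith []      = elevated
  elevatedWith (_ ∷ _) = elevated⁺

  shape-insertUD : ∀ {x} → Dyck x → ∀ y →
    shape (U ∷ x ++ D ∷ U ∷ D ∷ y) ≡ elevated⁺ ⇔ shape (U ∷ x ++ D ∷ y) ≡ elevatedWith y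
  shape-insertUD {x} dx y rewrite shape-cons dx (U ∷ D ∷ y) | shape-cons dx y with valleyHeights x | y
  ... | []    | []    = mk⇔ (λ ()) (λ ())
  ... | []    | _ ∷ _ = mk⇔ (λ ()) (λ ())
  ... | _ ∷ _ | []    = mk⇔ (λ _ → refl) (λ _ → refl)
  ... | _ ∷ _ | _ ∷ _ = mk⇔ (λ _ → refl) (λ _ → refl)

  elevated-tail : ∀ {x y} → Dyck x → shape (U ∷ x ++ D ∷ y) ≡ elevated → y ≡ []
  elevated-tail {x} {y} dx e = shapeFrom-elevated (valleyHeights x) y (trans (sym (shape-cons dx y)) e)

  record Good (n k : ℕ) (w : List Step) : Set where
    constructor good
    field
      dyck       : Dyck w
      semilength : length w ≡ n + n
      unimodal   : Unimodal (valleyHeights w)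
      pairs      : equalAdjacent (valleyHeights w) ≡ k

  record Class (c : Shape) (n k : ℕ) (w : List Step) : Set where
    constructor _∶_
    field
      isGood : Good n k w
      shaped : shape w ≡ c

  Counted⇔Good : ∀ {n k w} → Counted n k w ⇔ Good n k w
  Counted⇔Good {n} = mk⇔
    (λ (l , d , wu , s) → good (IsDyck⇒Dyck d) (trans l twice) (WeaklyUnimodal⇒Unimodal wu) s)
    (λ (good d l u s) → trans l (sym twice) , Dyck⇒IsDyck d , Unimodal⇒WeaklyUnimodal u , s)
    where
    twice : 2 * n ≡ n + n
    twice = cong (n +_) (+-identityʳ n)

  ValleyStep : ℕ → List ℕ → List ℕ → Set
  ValleyStep d vs′ vs = (Unimodal vs′ ⇔ Unimodal vs) × equalAdjacent vs′ ≡ d + equalAdjacent vs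

  sameValleys : ∀ {vs′ vs} → vs′ ≡ vs → ValleyStep 0 vs′ vs
  sameValleys refl = mk⇔ (λ u → u) (λ u → u) , refl

  Good-step : ∀ {w′ w} d → (Dyck w′ ⇔ Dyck w) → length w′ ≡ 2 + length w →
    (Dyck w → ValleyStep d (valleyHeights w′) (valleyHeights w)) →
    ∀ {n k} → Good (suc n) k w′ ⇔ (Σ[ k′ ∈ ℕ ] k ≡ d + k′ × Good n k′ w)
  Good-step {w′} {w} d dyck len facts {n} {k} = mk⇔ to from
    where
    to : Good (suc n) k w′ → Σ[ k′ ∈ ℕ ] k ≡ d + k′ × Good n k′ w
    to (good dw′ l u s) with facts (Equivalence.to dyck dw′)
    ... | uni , pairs =
      _ , trans (sym s) pairs ,
      good (Equivalence.to dyck dw′)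
           (suc-injective (suc-injective (trans (sym len) (trans l (cong suc (+-suc n n))))))
           (Equivalence.to uni u) refl
    from : (Σ[ k′ ∈ ℕ ] k ≡ d + k′ × Good n k′ w) → Good (suc n) k w′
    from (k′ , refl , good dw l u refl) with facts dw
    ... | uni , pairs =
      good (Equivalence.from dyck dw) (trans len (cong suc (trans (cong suc l) (sym (+-suc n n)))))
           (Equivalence.from uni u) pairs

  Good-step₀ : ∀ {w′ w} → (Dyck w′ ⇔ Dyck w) → length w′ ≡ 2 + length w →
    (Dyck w → ValleyStep 0 (valleyHeights w′) (valleyHeights w)) → ∀ {n k} → Good (suc n) k w′ ⇔ Good n k w
  Good-step₀ {w′} {w} dyck len facts {n} {k} = mk⇔
    (λ g → case Equivalence.to shifted g of λ { (_ , refl , g′) → g′ })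
    (λ g → Equivalence.from shifted (k , refl , g))
    where
    shifted : Good (suc n) k w′ ⇔ (Σ[ k′ ∈ ℕ ] k ≡ k′ × Good n k′ w)
    shifted = Good-step 0 dyck len facts

  Class⇔ : ∀ {c n′ k′ w′ n k w} → Good n′ k′ w′ ⇔ Good n k w → shape w′ ≡ shape w →
    Class c n′ k′ w′ ⇔ Class c n k w
  Class⇔ g⇔ same = mk⇔ (λ (g ∶ s) → Equivalence.to g⇔ g ∶ trans (sym same) s)
                       (λ (g ∶ s) → Equivalence.from g⇔ g ∶ trans same s)

  length-cons-tail : ∀ x {z′ z} → length z′ ≡ 2 + length z →
    length (U ∷ x ++ D ∷ z′) ≡ 2 + length (U ∷ x ++ D ∷ z)
  length-cons-tail x {z′} {z} l = cong suc (begin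
    length (x ++ D ∷ z′)       ≡⟨ length-++ x ⟩
    length x + suc (length z′) ≡⟨ cong (λ m → length x + suc m) l ⟩
    length x + (3 + length z)  ≡⟨ +-suc (length x) _ ⟩
    suc (length x + (2 + length z)) ≡⟨ cong suc (+-suc (length x) _) ⟩
    2 + (length x + suc (length z)) ≡⟨ cong (2 +_) (sym (length-++ x)) ⟩
    2 + length (x ++ D ∷ z) ∎)
    where open ≡-Reasoning

  hill-grow : ∀ {c n k} j y → Class c (suc n) k (hill (suc j) y) ⇔ Class c n k (hill j y)
  hill-grow j y = Class⇔
    (Good-step₀ (mk⇔ (Equivalence.from (Dyck-hill⇔ j) ∘ Equivalence.to (Dyck-hill⇔ (suc j)))
                     (Equivalence.from (Dyck-hill⇔ (suc j)) ∘ Equivalence.to (Dyck-hill⇔ j)))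
                (length-hill-suc j y)
                (λ d → let dy = Equivalence.to (Dyck-hill⇔ j) d in
                       sameValleys (trans (valleyHeights-hill (suc j) dy) (sym (valleyHeights-hill j dy)))))
    (trans (shape-hill (suc j) y) (sym (shape-hill j y)))

  valleyHeights-cons-hill : ∀ {x y} j → Dyck x → Dyck y →
    valleyHeights (U ∷ x ++ D ∷ hill j y) ≡ map suc (valleyHeights x) ++ 0 ∷ returnValleys y
  valleyHeights-cons-hill j dx dy
    rewrite valleyHeights-cons dx (Equivalence.from (Dyck-hill⇔ j) dy) | valleyHeights-hill j dy = refl

  elevated-grow : ∀ {c n k x} j y → Dyck x →
    Class c (suc n) k (U ∷ x ++ D ∷ hill (suc j) y) ⇔ Class c n k (U ∷ x ++ D ∷ hill j y)
  elevated-grow {x = x} j y dx = Class⇔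
    (Good-step₀ (mk⇔ (tail⇒ (suc j) j) (tail⇒ j (suc j))) (length-cons-tail x (length-hill-suc j y))
                (λ d → let dy = Equivalence.to (Dyck-hill⇔ j) (Dyck-cons⁻ dx d) in
                       sameValleys (trans (valleyHeights-cons-hill (suc j) dx dy) (sym (valleyHeights-cons-hill j dx dy)))))
    (trans (shape-cons dx (hill (suc j) y)) (trans (shapeFrom-cons (valleyHeights x)) (sym (shape-cons dx (hill j y)))))
    where
    tail⇒ : ∀ i i′ → Dyck (U ∷ x ++ D ∷ hill i y) → Dyck (U ∷ x ++ D ∷ hill i′ y)
    tail⇒ i i′ d = cons dx (Equivalence.from (Dyck-hill⇔ i′) (Equivalence.to (Dyck-hill⇔ i) (Dyck-cons⁻ dx d)))

  -- 1 when y begins with a pyramid followed by more: then U D y gets a new pair of valleys at height 0.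
  leadingPair : Shape → ℕ
  leadingPair pyramidal⁺ = 1
  leadingPair _          = 0

  equalAdjacent-returnValleys : ∀ {y} → Dyck y →
    equalAdjacent (returnValleys y) ≡ leadingPair (shape y) + equalAdjacent (valleyHeights y)
  equalAdjacent-returnValleys nil = refl
  equalAdjacent-returnValleys (cons {x} {y} dx dy)
    rewrite valleyHeights-cons dx dy | shape-cons dx y with valleyHeights x | dy
  ... | []    | nil      = refl
  ... | []    | cons _ _ = refl
  ... | _ ∷ _ | nil      = refl
  ... | _ ∷ _ | cons _ _ = refl

  Unimodal-returnValleys⇔ : ∀ y → Unimodal (returnValleys y) ⇔ Unimodal (valleyHeights y)
  Unimodal-returnValleys⇔ []      = mk⇔ (λ u → u) (λ u → u)
  Unimodal-returnValleys⇔ (_ ∷ _) = Unimodal-zero∷⇔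

  Good-UD : ∀ {n k y} → Good (suc n) k (U ∷ D ∷ y) ⇔ (Σ[ k′ ∈ ℕ ] k ≡ leadingPair (shape y) + k′ × Good n k′ y)
  Good-UD {y = y} = Good-step (leadingPair (shape y)) (Dyck-hill⇔ 0) refl facts
    where
    facts : Dyck y → ValleyStep (leadingPair (shape y)) (valleyHeights (U ∷ D ∷ y)) (valleyHeights y)
    facts dy rewrite valleyHeights-hill 0 dy = Unimodal-returnValleys⇔ y , equalAdjacent-returnValleys dy

  Valleyed : ℕ → ℕ → List Step → Set
  Valleyed n k w = Class pyramidal⁺ n k w ⊎ Class elevated n k w ⊎ Class elevated⁺ n k w

  NonHill : ℕ → ℕ → List Step → Set
  NonHill n k w = Class pyramidal n k w ⊎ Class elevated n k w ⊎ Class elevated⁺ n k w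

  hill-zero : ∀ {n k y} → Class pyramidal⁺ (suc n) k (U ∷ D ∷ y) ⇔ (NonHill n k y ⊎ Below (Class pyramidal⁺ n) k y)
  hill-zero {n} {k} {y} = mk⇔ to from
    where
    to : Class pyramidal⁺ (suc n) k (U ∷ D ∷ y) → NonHill n k y ⊎ Below (Class pyramidal⁺ n) k y
    to (g ∶ sh) with shape y in e | Equivalence.to Good-UD g
    ... | empty      | _ , _ , g′ with shape-empty (Good.dyck g′) e
    ...   | refl = case sh of λ ()
    to _ | pyramidal  | _ , refl , g′  = inj₁ (inj₁ (g′ ∶ e))
    to _ | elevated   | _ , refl , g′  = inj₁ (inj₂ (inj₁ (g′ ∶ e)))
    to _ | elevated⁺  | _ , refl , g′  = inj₁ (inj₂ (inj₂ (g′ ∶ e)))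
    to _ | pyramidal⁺ | k′ , refl , g′ = inj₂ (k′ , refl , g′ ∶ e)
    lift : ∀ {c k′} → k ≡ leadingPair c + k′ → ¬ c ≡ empty → Class c n k′ y → Class pyramidal⁺ (suc n) k (U ∷ D ∷ y)
    lift k≡ c≢empty (g ∶ e) =
      Equivalence.from Good-UD (_ , trans k≡ (cong (λ c → leadingPair c + _) (sym e)) , g) ∶ UD-shape e c≢empty
    from : NonHill n k y ⊎ Below (Class pyramidal⁺ n) k y → Class pyramidal⁺ (suc n) k (U ∷ D ∷ y)
    from (inj₁ (inj₁ c))        = lift refl (λ ()) c
    from (inj₁ (inj₂ (inj₁ c))) = lift refl (λ ()) c
    from (inj₁ (inj₂ (inj₂ c))) = lift refl (λ ()) c
    from (inj₂ (_ , refl , c))  = lift refl (λ ()) c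

  Good-raise : ∀ {n k x} → Dyck x → Good (suc n) k (U ∷ x ++ D ∷ []) ⇔ Good n k x
  Good-raise {x = x} dx = Good-step₀ (mk⇔ (λ _ → dx) (λ _ → cons dx nil))
    (cong suc (trans (length-++-sucʳ x D []) (cong (suc ∘ length) (++-identityʳ x)))) facts
    where
    facts : Dyck x → ValleyStep 0 (valleyHeights (U ∷ x ++ D ∷ [])) (valleyHeights x)
    facts _ rewrite valleyHeights-cons dx nil | ++-identityʳ (map suc (valleyHeights x)) =
      Unimodal-map-suc⇔ , equalAdjacent-map-suc (valleyHeights x)

  raise-step : ∀ {n k x} → Dyck x → Class elevated (suc n) k (U ∷ x ++ D ∷ []) ⇔ Valleyed n k x
  raise-step {n} {k} {x} dx = mk⇔ to from
    where
    sources : ∀ {c} → Good n k x → shape x ≡ c → raisedShape c ≡ elevated →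
              Valleyed n k x
    sources {pyramidal⁺} g e _ = inj₁ (g ∶ e)
    sources {elevated}   g e _ = inj₂ (inj₁ (g ∶ e))
    sources {elevated⁺}  g e _ = inj₂ (inj₂ (g ∶ e))
    to : Class elevated (suc n) k (U ∷ x ++ D ∷ []) → Valleyed n k x
    to (g ∶ sh) = sources (Equivalence.to (Good-raise dx) g) refl (trans (sym (shape-raise dx)) sh)
    lift : ∀ {c} → raisedShape c ≡ elevated → Class c n k x → Class elevated (suc n) k (U ∷ x ++ D ∷ [])
    lift r (g ∶ e) = Equivalence.from (Good-raise dx) g ∶ trans (shape-raise dx) (trans (cong raisedShape e) r)
    from : Valleyed n k x → Class elevated (suc n) k (U ∷ x ++ D ∷ [])
    from (inj₁ c)        = lift refl c
    from (inj₂ (inj₁ c)) = lift refl c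
    from (inj₂ (inj₂ c)) = lift refl c

  nonempty : List Step → ℕ
  nonempty []      = 0
  nonempty (_ ∷ _) = 1

  -- Inserting U D after the first return puts a valley of height 0 in front of the ground valleys of the
  -- tail: unimodality is unchanged, and a new equal pair appears iff the tail is nonempty.
  ValleyStep-insertGround : ∀ us y →
    ValleyStep (nonempty y) (map suc us ++ 0 ∷ returnValleys y) (map suc us ++ returnValleys y)
  ValleyStep-insertGround []         []      = Unimodal-zero∷⇔ , refl
  ValleyStep-insertGround []         (_ ∷ _) = Unimodal-zero∷⇔ , refl
  ValleyStep-insertGround us@(_ ∷ _) []
    rewrite ++-identityʳ (map suc us) =
    mk⇔ (λ u → Equivalence.from Unimodal-map-suc⇔ (proj₁ (Equivalence.to ground u)))
        (λ u → Equivalence.from ground (Equivalence.to Unimodal-map-suc⇔ u , [])) ,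
    trans (equalAdjacent-valley us []) (trans (+-identityʳ _) (sym (equalAdjacent-map-suc us)))
    where
    ground : Unimodal (map suc us ++ 0 ∷ []) ⇔ (Unimodal us × Zeros [])
    ground = Unimodal-valley⇔ us (λ ())
  ValleyStep-insertGround us@(_ ∷ _) y@(_ ∷ _) =
    mk⇔ (λ u → let uus , zs = Equivalence.to doubled u in Equivalence.from single (uus , All.tail zs))
        (λ u → let uus , zs = Equivalence.to single u in Equivalence.from doubled (uus , refl ∷ zs)) ,
    trans (equalAdjacent-valley us (0 ∷ valleyHeights y))
          (trans (+-suc _ _) (cong suc (sym (equalAdjacent-valley us (valleyHeights y)))))
    where
    doubled : Unimodal (map suc us ++ 0 ∷ 0 ∷ valleyHeights y) ⇔ (Unimodal us × Zeros (0 ∷ valleyHeights y))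
    doubled = Unimodal-valley⇔ us (λ ())
    single : Unimodal (map suc us ++ 0 ∷ valleyHeights y) ⇔ (Unimodal us × Zeros (valleyHeights y))
    single = Unimodal-valley⇔ us (λ ())

  Good-insertUD : ∀ {n k x y} → Dyck x →
    Good (suc n) k (U ∷ x ++ D ∷ U ∷ D ∷ y) ⇔ (Σ[ k′ ∈ ℕ ] k ≡ nonempty y + k′ × Good n k′ (U ∷ x ++ D ∷ y))
  Good-insertUD {x = x} {y} dx = Good-step (nonempty y)
    (mk⇔ (cons dx ∘ Equivalence.to (Dyck-hill⇔ 0) ∘ Dyck-cons⁻ dx)
         (cons dx ∘ Equivalence.from (Dyck-hill⇔ 0) ∘ Dyck-cons⁻ dx))
    (length-cons-tail x refl) facts
    where
    facts : Dyck (U ∷ x ++ D ∷ y) → ValleyStep (nonempty y) (valleyHeights (U ∷ x ++ D ∷ U ∷ D ∷ y))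
                                                           (valleyHeights (U ∷ x ++ D ∷ y))
    facts d rewrite valleyHeights-cons-hill 0 dx (Dyck-cons⁻ dx d) | valleyHeights-cons dx (Dyck-cons⁻ dx d) =
      ValleyStep-insertGround (valleyHeights x) y

  elevated⁺-step : ∀ {n k x} y → Dyck x → Class elevated⁺ (suc n) k (U ∷ x ++ D ∷ U ∷ D ∷ y) ⇔
    (Class elevated n k (U ∷ x ++ D ∷ y) ⊎ Below (Class elevated⁺ n) k (U ∷ x ++ D ∷ y))
  elevated⁺-step {n} {k} {x} [] dx = mk⇔ to from
    where
    to : Class elevated⁺ (suc n) k (U ∷ x ++ D ∷ U ∷ D ∷ []) →
         Class elevated n k (U ∷ x ++ D ∷ []) ⊎ Below (Class elevated⁺ n) k (U ∷ x ++ D ∷ [])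
    to (g ∶ sh) with Equivalence.to (Good-insertUD dx) g
    ... | _ , refl , g′ = inj₁ (g′ ∶ Equivalence.to (shape-insertUD dx []) sh)
    from : Class elevated n k (U ∷ x ++ D ∷ []) ⊎ Below (Class elevated⁺ n) k (U ∷ x ++ D ∷ []) →
           Class elevated⁺ (suc n) k (U ∷ x ++ D ∷ U ∷ D ∷ [])
    from (inj₁ (g ∶ e))         = Equivalence.from (Good-insertUD dx) (_ , refl , g) ∶ Equivalence.from (shape-insertUD dx []) e
    from (inj₂ (_ , _ , _ ∶ e)) = ⊥-elim (proj₂ (shapeFrom-elevated⁺ (valleyHeights x) [] (trans (sym (shape-cons dx [])) e)) refl)
  elevated⁺-step {n} {k} {x} y@(_ ∷ _) dx = mk⇔ to from
    where
    to : Class elevated⁺ (suc n) k (U ∷ x ++ D ∷ U ∷ D ∷ y) →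
         Class elevated n k (U ∷ x ++ D ∷ y) ⊎ Below (Class elevated⁺ n) k (U ∷ x ++ D ∷ y)
    to (g ∶ sh) with Equivalence.to (Good-insertUD dx) g
    ... | k′ , refl , g′ = inj₂ (k′ , refl , g′ ∶ Equivalence.to (shape-insertUD dx y) sh)
    from : Class elevated n k (U ∷ x ++ D ∷ y) ⊎ Below (Class elevated⁺ n) k (U ∷ x ++ D ∷ y) →
           Class elevated⁺ (suc n) k (U ∷ x ++ D ∷ U ∷ D ∷ y)
    from (inj₁ (_ ∶ e)) = case elevated-tail dx e of λ ()
    from (inj₂ (k′ , refl , g ∶ e)) =
      Equivalence.from (Good-insertUD dx) (k′ , refl , g) ∶ Equivalence.from (shape-insertUD dx y) e

  pyramidal⁺⇒hill : ∀ {n k w} → Class pyramidal⁺ n k w → Σ (ℕ × List Step) λ (j , y) → hill j y ≡ w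
  pyramidal⁺⇒hill (good nil _ _ _ ∶ ())
  pyramidal⁺⇒hill (good (cons {x} {y} dx _) _ _ _ ∶ e)
    with valleyless⇒pyramid dx (shapeFrom-pyramidal⁺ (valleyHeights x) (trans (sym (shape-cons dx y)) e))
  ... | j , refl = (j , y) , refl

  elevated⇒raised : ∀ {n k w} → Class elevated n k w → Σ (List Step) λ x → Dyck x × U ∷ x ++ D ∷ [] ≡ w
  elevated⇒raised (good nil _ _ _ ∶ ())
  elevated⇒raised (good (cons {x} dx _) _ _ _ ∶ e) with elevated-tail dx e
  ... | refl = x , dx , refl

  Zeros-map-suc : ∀ us {vs} → Zeros (map suc us ++ vs) → us ≡ []
  Zeros-map-suc []      _        = refl
  Zeros-map-suc (_ ∷ _) (() ∷ _)

  -- After a first component with valleys, unimodality forces all later valleys to height 0,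
  -- so the tail consists of pyramids.
  elevated⁺-tail : ∀ {n k x y} → Dyck x → Class elevated⁺ n k (U ∷ x ++ D ∷ y) →
    Σ (ℕ × List Step) λ (j , y′) → hill j y′ ≡ y
  elevated⁺-tail {x = x} {y} dx (good d _ u _ ∶ e) =
    tail (Dyck-cons⁻ dx d) u (trans (sym (shape-cons dx y)) e)
    where
    tail : ∀ {y} → Dyck y → Unimodal (valleyHeights (U ∷ x ++ D ∷ y)) → shapeFrom (valleyHeights x) y ≡ elevated⁺ →
           Σ (ℕ × List Step) λ (j , y′) → hill j y′ ≡ y
    tail {y} dy u sh with shapeFrom-elevated⁺ (valleyHeights x) y sh
    tail nil _ _ | _ , y≢[] = ⊥-elim (y≢[] refl)
    tail dy@(cons {x′} {y′} dx′ dy′) u _ | vx≢[] , _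
      with Equivalence.to (Unimodal-valley⇔ (valleyHeights x) vx≢[]) (subst Unimodal (valleyHeights-cons dx dy) u)
    ... | _ , zeros
      with valleyless⇒pyramid dx′ (Zeros-map-suc (valleyHeights x′) (subst Zeros (valleyHeights-cons dx′ dy′) zeros))
    ... | j , refl = (j , y′) , refl

  elevated⁺⇒hill : ∀ {n k w} → Class elevated⁺ n k w →
    Σ (ℕ × List Step × List Step) λ (j , x , y) → Dyck x × U ∷ x ++ D ∷ hill j y ≡ w
  elevated⁺⇒hill (good nil _ _ _ ∶ ())
  elevated⁺⇒hill c@(good (cons {x} dx _) _ _ _ ∶ _) with elevated⁺-tail dx c
  ... | (j , y) , refl = (j , x , y) , dx , refl

  length-pyramid : ∀ m → length (pyramid m) ≡ m + m
  length-pyramid zero    = refl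
  length-pyramid (suc m) = cong suc (trans (length-++-sucʳ (pyramid m) D [])
    (trans (cong suc (trans (cong length (++-identityʳ (pyramid m))) (length-pyramid m))) (sym (+-suc m m))))

  double-injective : ∀ {m n} → m + m ≡ n + n → m ≡ n
  double-injective {zero}  {zero}  _ = refl
  double-injective {suc m} {suc n} e =
    cong suc (double-injective (suc-injective (trans (sym (+-suc m m)) (trans (suc-injective e) (+-suc n n)))))

  pyramidal⇒pyramid : ∀ {n k w} → Class pyramidal n k w → Σ[ m ∈ ℕ ] n ≡ suc m × k ≡ 0 × pyramid (suc m) ≡ w
  pyramidal⇒pyramid (good nil _ _ _ ∶ ())
  pyramidal⇒pyramid {n} (good (cons {x} {y} dx _) l _ p ∶ e)
    with shapeFrom-pyramidal (valleyHeights x) y (trans (sym (shape-cons dx y)) e)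
  ... | vx≡[] , refl with valleyless⇒pyramid dx vx≡[]
  ... | m , refl =
    m , double-injective (trans (sym l) (length-pyramid (suc m))) ,
    trans (sym p) (cong equalAdjacent (valleyHeights-pyramid (suc m))) , refl

  pyramid∈pyramidal : ∀ m → Class pyramidal (suc m) 0 (pyramid (suc m))
  pyramid∈pyramidal m = good (Dyck-pyramid (suc m)) (length-pyramid (suc m))
    (subst Unimodal (sym (valleyHeights-pyramid (suc m))) (nonincreasing []))
    (cong equalAdjacent (valleyHeights-pyramid (suc m)))
    ∶ trans (shape-cons (Dyck-pyramid m) []) (cong (λ vs → shapeFrom vs []) (valleyHeights-pyramid m))

  empty⇒[] : ∀ {n k w} → Class empty n k w → n ≡ 0 × k ≡ 0 × w ≡ []
  empty⇒[] (good d l _ p ∶ e) with shape-empty d e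
  ... | refl = double-injective (sym l) , sym p , refl

  -- The recurrences mirror hill-zero and hill-grow (pyramidal⁺), raise-step (elevated) and
  -- elevated⁺-step and elevated-grow (elevated⁺); `below` accounts for a new pair of equal valleys.
  count : Shape → ℕ → ℕ → ℕ
  count empty      zero    zero    = 1
  count empty      _       _       = 0
  count pyramidal  (suc _) zero    = 1
  count pyramidal  _       _       = 0
  count pyramidal⁺ zero    _       = 0
  count pyramidal⁺ (suc n) k =
    ((count pyramidal n k + (count elevated n k + count elevated⁺ n k)) + below (count pyramidal⁺ n) k)
    + count pyramidal⁺ n k
  count elevated   zero    _       = 0
  count elevated   (suc n) k = count pyramidal⁺ n k + (count elevated n k + count elevated⁺ n k)
  count elevated⁺  zero    _       = 0
  count elevated⁺  (suc n) k = (count elevated n k + below (count elevated⁺ n) k) + count elevated⁺ n k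

  HillData : ℕ → ℕ → ℕ × List Step → Set
  HillData n k (j , y) = Class pyramidal⁺ n k (hill j y)

  RaisedData : ℕ → ℕ → List Step → Set
  RaisedData n k x = Dyck x × Class elevated n k (U ∷ x ++ D ∷ [])

  elevatedHill : ℕ × List Step × List Step → List Step
  elevatedHill (j , x , y) = U ∷ x ++ D ∷ hill j y

  ElevatedHillData : ℕ → ℕ → ℕ × List Step × List Step → Set
  ElevatedHillData n k p@(_ , x , _) = Dyck x × Class elevated⁺ n k (elevatedHill p)

  record DataEnumeration (n : ℕ) : Set where
    field
      hills         : ∀ k → Enumerates (HillData n k) (count pyramidal⁺ n k)
      raised        : ∀ k → Enumerates (RaisedData n k) (count elevated n k)
      elevatedHills : ∀ k → Enumerates (ElevatedHillData n k) (count elevated⁺ n k)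

  sameShape : ∀ {c c′ n n′ k k′ w} → Class c n k w → Class c′ n′ k′ w → c ≡ c′
  sameShape (_ ∶ e) (_ ∶ e′) = trans (sym e) e′

  enum-empty : ∀ n k → Enumerates (Class empty n k) (count empty n k)
  enum-empty zero zero = enum-singleton [] λ w →
    mk⇔ (λ { refl → good nil refl (nonincreasing []) refl ∶ refl }) (sym ∘ proj₂ ∘ proj₂ ∘ empty⇒[])
  enum-empty zero    (suc k) = enum-∅ λ _ c → case proj₁ (proj₂ (empty⇒[] c)) of λ ()
  enum-empty (suc n) _       = enum-∅ λ _ c → case proj₁ (empty⇒[] c) of λ ()

  enum-pyramidal : ∀ n k → Enumerates (Class pyramidal n k) (count pyramidal n k)
  enum-pyramidal (suc n) zero = enum-singleton (pyramid (suc n)) λ w →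
    mk⇔ (λ { refl → pyramid∈pyramidal n })
        (λ c → case pyramidal⇒pyramid c of λ { (_ , refl , _ , e) → e })
  enum-pyramidal zero    _       = enum-∅ λ _ c → case pyramidal⇒pyramid c of λ { (_ , () , _) }
  enum-pyramidal (suc n) (suc k) = enum-∅ λ _ c → case pyramidal⇒pyramid c of λ { (_ , _ , () , _) }

  classEnumeration : ∀ {n} → DataEnumeration n → ∀ c k → Enumerates (Class c n k) (count c n k)
  classEnumeration {n} _ empty     k = enum-empty n k
  classEnumeration {n} _ pyramidal k = enum-pyramidal n k
  classEnumeration E pyramidal⁺ k =
    enum-⇔ (Image⇔ _ (λ c → c) λ c → case pyramidal⁺⇒hill c of λ { (p , refl) → p , c , refl })
      (enum-image (λ (j , y) → hill j y) (λ _ _ e → let j≡ , y≡ = hill-injective e in cong₂ _,_ j≡ y≡)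
        (DataEnumeration.hills E k))
  classEnumeration E elevated k =
    enum-⇔ (Image⇔ _ proj₂ λ c → case elevated⇒raised c of λ { (x , dx , refl) → x , (dx , c) , refl })
      (enum-image (λ x → U ∷ x ++ D ∷ []) (λ (dx , _) (dx′ , _) e → proj₁ (cons-injective dx dx′ e))
        (DataEnumeration.raised E k))
  classEnumeration {n} E elevated⁺ k =
    enum-⇔ (Image⇔ _ proj₂ λ c → case elevated⁺⇒hill c of λ { (p , dx , refl) → p , (dx , c) , refl })
      (enum-image elevatedHill injective (DataEnumeration.elevatedHills E k))
    where
    injective : ∀ {p p′} → ElevatedHillData n k p → ElevatedHillData n k p′ → elevatedHill p ≡ elevatedHill p′ → p ≡ p′
    injective (dx , _) (dx′ , _) e with cons-injective dx dx′ e
    ... | refl , tail with hill-injective tail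
    ... | refl , refl = refl

  distinct : ∀ {c c′ n n′ k k′ w} → ¬ c ≡ c′ → Class c n k w → Class c′ n′ k′ w → ⊥
  distinct c≢c′ a b = c≢c′ (sameShape a b)

  module Unions {n : ℕ} (class : ∀ c k → Enumerates (Class c n k) (count c n k)) where

    enum-Elevated : ∀ k → Enumerates (λ w → Class elevated n k w ⊎ Class elevated⁺ n k w)
                                     (count elevated n k + count elevated⁺ n k)
    enum-Elevated k = enum-⊎ (distinct λ ()) (class elevated k) (class elevated⁺ k)

    enum-Valleyed : ∀ k → Enumerates (Valleyed n k) (count pyramidal⁺ n k + (count elevated n k + count elevated⁺ n k))
    enum-Valleyed k = enum-⊎ (λ { a (inj₁ b) → distinct (λ ()) a b ; a (inj₂ b) → distinct (λ ()) a b })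
                             (class pyramidal⁺ k) (enum-Elevated k)

    enum-NonHill : ∀ k → Enumerates (NonHill n k) (count pyramidal n k + (count elevated n k + count elevated⁺ n k))
    enum-NonHill k = enum-⊎ (λ { a (inj₁ b) → distinct (λ ()) a b ; a (inj₂ b) → distinct (λ ()) a b })
                            (class pyramidal k) (enum-Elevated k)

  ElevatedHillData-zero⇔ : ∀ n k (p : List Step × List Step) →
    (Image (_, []) (RaisedData n k) p ⊎ Image (λ (j , x , y) → x , hill j y) (Below (ElevatedHillData n) k) p)
    ⇔ ElevatedHillData (suc n) k (0 , p)
  ElevatedHillData-zero⇔ n k (x , y) = mk⇔ to from
    where
    to : Image (_, []) (RaisedData n k) (x , y) ⊎ Image (λ (j , x , y) → x , hill j y) (Below (ElevatedHillData n) k) (x , y) →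
         ElevatedHillData (suc n) k (0 , x , y)
    to (inj₁ (_ , (dx , c) , refl)) = dx , Equivalence.from (elevated⁺-step [] dx) (inj₁ c)
    to (inj₂ ((j , _ , y′) , (k′ , refl , dx , c) , refl)) =
      dx , Equivalence.from (elevated⁺-step (hill j y′) dx) (inj₂ (k′ , refl , c))
    from : ElevatedHillData (suc n) k (0 , x , y) →
           Image (_, []) (RaisedData n k) (x , y) ⊎ Image (λ (j , x , y) → x , hill j y) (Below (ElevatedHillData n) k) (x , y)
    from (dx , c) with Equivalence.to (elevated⁺-step y dx) c
    ... | inj₁ c′ with elevated-tail dx (Class.shaped c′)
    ...   | refl = inj₁ (x , (dx , c′) , refl)
    from (dx , c) | inj₂ (k′ , refl , c′) with elevated⁺-tail dx c′
    ...   | (j , y′) , refl = inj₂ ((j , x , y′) , (k′ , refl , dx , c′) , refl)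

  dataEnumeration : ∀ n → DataEnumeration n
  dataEnumeration zero = record
    { hills         = λ _ → enum-∅ λ { _ (good _ () _ _ ∶ _) }
    ; raised        = λ _ → enum-∅ λ { _ (_ , good _ () _ _ ∶ _) }
    ; elevatedHills = λ _ → enum-∅ λ { _ (_ , good _ () _ _ ∶ _) } }
  dataEnumeration (suc n) = record { hills = hills ; raised = raised ; elevatedHills = elevatedHills }
    where
    E : DataEnumeration n
    E = dataEnumeration n
    class : ∀ c k → Enumerates (Class c n k) (count c n k)
    class = classEnumeration E
    open Unions class
    hillSource : ∀ k → Enumerates (λ y → NonHill n k y ⊎ Below (Class pyramidal⁺ n) k y)
                                  (count pyramidal n k + (count elevated n k + count elevated⁺ n k)
                                   + below (count pyramidal⁺ n) k)
    hillSource k = enum-⊎ (λ { (inj₁ a)        (_ , _ , b) → distinct (λ ()) a b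
                              ; (inj₂ (inj₁ a)) (_ , _ , b) → distinct (λ ()) a b
                              ; (inj₂ (inj₂ a)) (_ , _ , b) → distinct (λ ()) a b })
                     (enum-NonHill k) (enum-Below (class pyramidal⁺) k)
    hills : ∀ k → Enumerates (HillData (suc n) k) (count pyramidal⁺ (suc n) k)
    hills k = enum-ℕ× (enum-⇔ (λ y → ⇔.sym hill-zero) (hillSource k))
                      (enum-⇔ (λ (j , y) → ⇔.sym (hill-grow j y)) (DataEnumeration.hills E k))
    raised : ∀ k → Enumerates (RaisedData (suc n) k) (count elevated (suc n) k)
    raised k = enum-⇔ (λ x → mk⇔ (λ v → Good.dyck (valleyedGood v) , Equivalence.from (raise-step (Good.dyck (valleyedGood v))) v)
                                 (λ (dx , c) → Equivalence.to (raise-step dx) c))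
                      (enum-Valleyed k)
      where
      valleyedGood : ∀ {x} → Valleyed n k x → Good n k x
      valleyedGood (inj₁ c)        = Class.isGood c
      valleyedGood (inj₂ (inj₁ c)) = Class.isGood c
      valleyedGood (inj₂ (inj₂ c)) = Class.isGood c
    elevatedHills : ∀ k → Enumerates (ElevatedHillData (suc n) k) (count elevated⁺ (suc n) k)
    elevatedHills k = enum-ℕ×
      (enum-⇔ (ElevatedHillData-zero⇔ n k)
        (enum-⊎ (λ { (_ , _ , refl) (_ , _ , ()) })
          (enum-image (_, []) (λ _ _ → cong proj₁) (DataEnumeration.raised E k))
          (enum-image (λ (j , x , y) → x , hill j y) (λ _ _ → pairs-injective)
            (enum-Below (DataEnumeration.elevatedHills E) k))))
      (enum-⇔ (λ (j , x , y) → mk⇔ (λ (dx , c) → dx , Equivalence.from (elevated-grow j y dx) c)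
                                   (λ (dx , c) → dx , Equivalence.to (elevated-grow j y dx) c))
              (DataEnumeration.elevatedHills E k))
      where
      pairs-injective : ∀ {p p′ : ℕ × List Step × List Step} →
        (λ (j , x , y) → x , hill j y) p ≡ (λ (j , x , y) → x , hill j y) p′ → p ≡ p′
      pairs-injective {_ , _ , _} {_ , _ , _} e with cong proj₁ e | hill-injective (cong proj₂ e)
      ... | refl | refl , refl = refl

  wordCount : ℕ → ℕ → ℕ
  wordCount n k = count empty n k + (count pyramidal n k + (count pyramidal⁺ n k + (count elevated n k + count elevated⁺ n k)))

  enum-Good : ∀ n k → Enumerates (Good n k) (wordCount n k)
  enum-Good n k = enum-⇔ (λ w → mk⇔ good-of (λ g → byShape g refl))
    (enum-⊎ (λ { a (inj₁ b)                      → distinct (λ ()) a b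
               ; a (inj₂ (inj₁ b))               → distinct (λ ()) a b
               ; a (inj₂ (inj₂ (inj₁ b)))        → distinct (λ ()) a b
               ; a (inj₂ (inj₂ (inj₂ b)))        → distinct (λ ()) a b })
      (class empty k)
      (enum-⊎ (λ { a (inj₁ b)        → distinct (λ ()) a b
                 ; a (inj₂ (inj₁ b)) → distinct (λ ()) a b
                 ; a (inj₂ (inj₂ b)) → distinct (λ ()) a b })
        (class pyramidal k) (enum-Valleyed k)))
    where
    class : ∀ c k → Enumerates (Class c n k) (count c n k)
    class = classEnumeration (dataEnumeration n)
    open Unions class
    AnyShape : List Step → Set
    AnyShape w = Class empty n k w ⊎ Class pyramidal n k w ⊎ Valleyed n k w
    good-of : ∀ {w} → AnyShape w → Good n k w
    good-of (inj₁ c)                      = Class.isGood c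
    good-of (inj₂ (inj₁ c))               = Class.isGood c
    good-of (inj₂ (inj₂ (inj₁ c)))        = Class.isGood c
    good-of (inj₂ (inj₂ (inj₂ (inj₁ c)))) = Class.isGood c
    good-of (inj₂ (inj₂ (inj₂ (inj₂ c)))) = Class.isGood c
    byShape : ∀ {w c} → Good n k w → shape w ≡ c → AnyShape w
    byShape {c = empty}      g e = inj₁ (g ∶ e)
    byShape {c = pyramidal}  g e = inj₂ (inj₁ (g ∶ e))
    byShape {c = pyramidal⁺} g e = inj₂ (inj₂ (inj₁ (g ∶ e)))
    byShape {c = elevated}   g e = inj₂ (inj₂ (inj₂ (inj₁ (g ∶ e))))
    byShape {c = elevated⁺}  g e = inj₂ (inj₂ (inj₂ (inj₂ (g ∶ e))))

  enumerateCounted : ∀ n k → HasCard (Counted n k) (wordCount n k)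
  enumerateCounted n k = enum-⇔ (λ w → ⇔.sym Counted⇔Good) (enum-Good n k)

module Algebra where

  open import Data.Nat as ℕ using (zero; suc; _∸_; _≤?_; _<?_)
  import Data.Nat.Properties as ℕ
  open import Data.Integer using (ℤ; +_; -_; _+_; _-_; _*_)
  import Data.Integer.Properties as ℤ
  open import Data.Integer.Tactic.RingSolver using (solve-∀)
  open import Data.Bool using (true; false; if_then_else_; _∧_)
  open import Data.List using ([]; _∷_; _++_; map)
  open import Data.List.Relation.Unary.All as All using (All; []; _∷_)
  open import Data.Vec as Vec using (Vec; []; _∷_; zipWith; replicate; lookup)
  open import Data.Fin using (Fin; zero; suc; toℕ; fromℕ<)
  import Data.Fin.Properties as Fin
  open import Data.Sum using (_⊎_; inj₁; inj₂; [_,_]′)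
  open import Data.Empty using (⊥-elim)
  open import Function using (_∘_)
  open import Relation.Nullary using (Dec; does; yes; no)
  open import Relation.Nullary.Decidable using (True; toWitness; _×-dec_)
  open import Relation.Binary.PropositionalEquality
  open Counting using (Shape; empty; pyramidal; pyramidal⁺; elevated; elevated⁺; below; count; wordCount)

  private
    variable
      m r : ℕ

  mulTerm : Term → Series → Series
  mulTerm (c , i , j) f n k = if does (j ≤? n) ∧ does (i ≤? k) then c * f (n ∸ j) (k ∸ i) else + 0

  mulPoly-++ : ∀ P Q f n k → mulPoly (P ++ Q) f n k ≡ mulPoly P f n k + mulPoly Q f n k
  mulPoly-++ []      Q f n k = sym (ℤ.+-identityˡ _)
  mulPoly-++ (t ∷ P) Q f n k =
    trans (cong (λ v → mulTerm t f n k + v) (mulPoly-++ P Q f n k)) (sym (ℤ.+-assoc (mulTerm t f n k) _ _))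

  mulPoly-cong : ∀ P {f g : Series} → (∀ n k → f n k ≡ g n k) → ∀ n k → mulPoly P f n k ≡ mulPoly P g n k
  mulPoly-cong []                e n k = refl
  mulPoly-cong ((c , i , j) ∷ P) e n k =
    cong₂ _+_ (cong (λ v → if does (j ≤? n) ∧ does (i ≤? k) then c * v else + 0) (e _ _)) (mulPoly-cong P e n k)

  interchange : ∀ (a b c d : ℤ) → (a + b) + (c + d) ≡ (a + c) + (b + d)
  interchange = solve-∀

  mulTerm-+ : ∀ t (f g : Series) n k → mulTerm t (λ a b → f a b + g a b) n k ≡ mulTerm t f n k + mulTerm t g n k
  mulTerm-+ (c , i , j) f g n k = distrib (does (j ≤? n) ∧ does (i ≤? k))
    where
    distrib : ∀ b → (if b then c * (f (n ∸ j) (k ∸ i) + g (n ∸ j) (k ∸ i)) else + 0)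
                  ≡ (if b then c * f (n ∸ j) (k ∸ i) else + 0) + (if b then c * g (n ∸ j) (k ∸ i) else + 0)
    distrib true  = ℤ.*-distribˡ-+ c _ _
    distrib false = refl

  mulTerm-zero : ∀ t n k → mulTerm t (λ _ _ → + 0) n k ≡ + 0
  mulTerm-zero (c , i , j) n k = vanish (does (j ≤? n) ∧ does (i ≤? k))
    where
    vanish : ∀ b → (if b then c * + 0 else + 0) ≡ + 0
    vanish true  = ℤ.*-zeroʳ c
    vanish false = refl

  mulPoly-+ : ∀ P (f g : Series) n k → mulPoly P (λ a b → f a b + g a b) n k ≡ mulPoly P f n k + mulPoly P g n k
  mulPoly-+ []      f g n k = refl
  mulPoly-+ (t ∷ P) f g n k =
    trans (cong₂ _+_ (mulTerm-+ t f g n k) (mulPoly-+ P f g n k))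
          (interchange (mulTerm t f n k) (mulTerm t g n k) (mulPoly P f n k) (mulPoly P g n k))

  mulPoly-zero : ∀ P {f : Series} → (∀ n k → f n k ≡ + 0) → ∀ n k → mulPoly P f n k ≡ + 0
  mulPoly-zero P {f} f≡0 n k = trans (mulPoly-cong P f≡0 n k) (vanish P)
    where
    vanish : ∀ P → mulPoly P (λ _ _ → + 0) n k ≡ + 0
    vanish []      = refl
    vanish (t ∷ P) = cong₂ _+_ (mulTerm-zero t n k) (vanish P)

  negate : Poly → Poly
  negate = map λ (c , i , j) → - c , i , j

  mulPoly-negate : ∀ P f n k → mulPoly (negate P) f n k ≡ - mulPoly P f n k
  mulPoly-negate []                f n k = refl
  mulPoly-negate ((c , i , j) ∷ P) f n k =
    trans (cong₂ _+_ (neg-term (does (j ≤? n) ∧ does (i ≤? k))) (mulPoly-negate P f n k))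
          (sym (ℤ.neg-distrib-+ (mulTerm (c , i , j) f n k) (mulPoly P f n k)))
    where
    neg-term : ∀ b → (if b then - c * f (n ∸ j) (k ∸ i) else + 0) ≡ - (if b then c * f (n ∸ j) (k ∸ i) else + 0)
    neg-term true  = sym (ℤ.neg-distribˡ-* c _)
    neg-term false = refl

  _·ₜ_ : Term → Term → Term
  (c , i , j) ·ₜ (c′ , i′ , j′) = c * c′ , i ℕ.+ i′ , j ℕ.+ j′

  _⊗_ : Poly → Poly → Poly
  []      ⊗ Q = []
  (t ∷ P) ⊗ Q = map (t ·ₜ_) Q ++ P ⊗ Q

  ≤?-suc : ∀ a b → does (suc a ≤? suc b) ≡ does (a ≤? b)
  ≤?-suc zero    b = refl
  ≤?-suc (suc a) b = refl

  ≤?-+ : ∀ j j′ n → (does (j ≤? n) ∧ does (j′ ≤? n ∸ j)) ≡ does (j ℕ.+ j′ ≤? n)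
  ≤?-+ zero    j′ n       = refl
  ≤?-+ (suc j) j′ zero    = refl
  ≤?-+ (suc j) j′ (suc n) rewrite ≤?-suc j n | ≤?-suc (j ℕ.+ j′) n = ≤?-+ j j′ n

  mulTerm-mulTerm : ∀ t t′ f n k → mulTerm t (mulTerm t′ f) n k ≡ mulTerm (t ·ₜ t′) f n k
  mulTerm-mulTerm (c , i , j) (c′ , i′ , j′) f n k
    rewrite sym (≤?-+ j j′ n) | sym (≤?-+ i i′ k) | ℕ.∸-+-assoc n j j′ | ℕ.∸-+-assoc k i i′ =
    nested (does (j ≤? n)) (does (i ≤? k)) (does (j′ ≤? n ∸ j)) (does (i′ ≤? k ∸ i))
    where
    nested : ∀ b₁ b₂ b₃ b₄ {x} →
      (if b₁ ∧ b₂ then c * (if b₃ ∧ b₄ then c′ * x else + 0) else + 0) ≡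
      (if (b₁ ∧ b₃) ∧ (b₂ ∧ b₄) then c * c′ * x else + 0)
    nested true  true  true  true  = sym (ℤ.*-assoc c c′ _)
    nested true  true  true  false = ℤ.*-zeroʳ c
    nested true  true  false _     = ℤ.*-zeroʳ c
    nested true  false true  _     = refl
    nested true  false false _     = refl
    nested false _     _     _     = refl

  mulTerm-mulPoly : ∀ t Q f n k → mulTerm t (mulPoly Q f) n k ≡ mulPoly (map (t ·ₜ_) Q) f n k
  mulTerm-mulPoly t []       f n k = mulTerm-zero t n k
  mulTerm-mulPoly t (t′ ∷ Q) f n k =
    trans (mulTerm-+ t (mulTerm t′ f) (mulPoly Q f) n k)
          (cong₂ _+_ (mulTerm-mulTerm t t′ f n k) (mulTerm-mulPoly t Q f n k))

  mulPoly-⊗ : ∀ P Q f n k → mulPoly P (mulPoly Q f) n k ≡ mulPoly (P ⊗ Q) f n k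
  mulPoly-⊗ []      Q f n k = refl
  mulPoly-⊗ (t ∷ P) Q f n k =
    trans (cong₂ _+_ (mulTerm-mulPoly t Q f n k) (mulPoly-⊗ P Q f n k))
          (sym (mulPoly-++ (map (t ·ₜ_) Q) (P ⊗ Q) f n k))

  ∑≤ : ℕ → (ℕ → ℤ) → ℤ
  ∑≤ zero    g = g 0
  ∑≤ (suc n) g = ∑≤ n g + g (suc n)

  ∑≤-cong : ∀ n {g h : ℕ → ℤ} → (∀ j → g j ≡ h j) → ∑≤ n g ≡ ∑≤ n h
  ∑≤-cong zero    e = e 0
  ∑≤-cong (suc n) e = cong₂ _+_ (∑≤-cong n e) (e (suc n))

  ∑≤-+ : ∀ n (g h : ℕ → ℤ) → ∑≤ n (λ j → g j + h j) ≡ ∑≤ n g + ∑≤ n h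
  ∑≤-+ zero    g h = refl
  ∑≤-+ (suc n) g h =
    trans (cong (_+ (g (suc n) + h (suc n))) (∑≤-+ n g h)) (interchange (∑≤ n g) (∑≤ n h) (g (suc n)) (h (suc n)))

  ∑≤-if : ∀ n b (g : ℕ → ℤ) → ∑≤ n (λ j → if b then g j else + 0) ≡ (if b then ∑≤ n g else + 0)
  ∑≤-if n       true  g = refl
  ∑≤-if zero    false g = refl
  ∑≤-if (suc n) false g = cong (_+ + 0) (∑≤-if n false g)

  ∑≤-indicator : ∀ a n (g : ℕ → ℤ) → ∑≤ n (λ j → if does (a ℕ.≟ j) then g j else + 0) ≡ (if does (a ≤? n) then g a else + 0)
  ∑≤-indicator zero    zero    g = refl
  ∑≤-indicator (suc a) zero    g = refl
  ∑≤-indicator a       (suc n) g =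
    trans (cong (_+ (if does (a ℕ.≟ suc n) then g (suc n) else + 0)) (∑≤-indicator a n g))
          (step (a ≤? n) (a ℕ.≟ suc n) (a ≤? suc n))
    where
    step : (a≤n? : Dec (a ℕ.≤ n)) (a≡1+n? : Dec (a ≡ suc n)) (a≤1+n? : Dec (a ℕ.≤ suc n)) →
      (if does a≤n? then g a else + 0) + (if does a≡1+n? then g (suc n) else + 0) ≡ (if does a≤1+n? then g a else + 0)
    step (yes a≤n) (yes refl)  _             = ⊥-elim (ℕ.<-irrefl refl a≤n)
    step (yes _)   (no _)      (yes _)       = ℤ.+-identityʳ (g a)
    step (yes a≤n) (no _)      (no a≰1+n)    = ⊥-elim (a≰1+n (ℕ.m≤n⇒m≤1+n a≤n))
    step (no _)    (yes refl)  (yes _)       = ℤ.+-identityˡ (g (suc n))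
    step (no _)    (yes refl)  (no a≰1+n)    = ⊥-elim (a≰1+n ℕ.≤-refl)
    step (no a≰n)  (no a≢1+n)  (yes a≤1+n)   = ⊥-elim ([ a≰n ∘ ℕ.s≤s⁻¹ , a≢1+n ]′ (ℕ.m≤n⇒m<n∨m≡n a≤1+n))
    step (no _)    (no _)      (no _)        = refl

  convolution : (ℕ → ℕ → ℤ) → Series → Series
  convolution a f n k = ∑≤ n λ j → ∑≤ k λ i → a j i * f (n ∸ j) (k ∸ i)

  termCoeff : Term → ℕ → ℕ → ℤ
  termCoeff (c , i′ , j′) j i = if does (i′ ℕ.≟ i) ∧ does (j′ ℕ.≟ j) then c else + 0

  mulTerm-convolution : ∀ t f n k → mulTerm t f n k ≡ convolution (termCoeff t) f n k
  mulTerm-convolution (c , i′ , j′) f n k = sym (begin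
    ∑≤ n (λ j → ∑≤ k λ i → (if does (i′ ℕ.≟ i) ∧ does (j′ ℕ.≟ j) then c else + 0) * F j i)
      ≡⟨ ∑≤-cong n (λ j → ∑≤-cong k λ i → split (does (i′ ℕ.≟ i)) (does (j′ ℕ.≟ j)) (F j i)) ⟩
    ∑≤ n (λ j → ∑≤ k λ i → if does (j′ ℕ.≟ j) then (if does (i′ ℕ.≟ i) then c * F j i else + 0) else + 0)
      ≡⟨ ∑≤-cong n (λ j → ∑≤-if k (does (j′ ℕ.≟ j)) _) ⟩
    ∑≤ n (λ j → if does (j′ ℕ.≟ j) then ∑≤ k (λ i → if does (i′ ℕ.≟ i) then c * F j i else + 0) else + 0)
      ≡⟨ ∑≤-cong n (λ j → cong (λ v → if does (j′ ℕ.≟ j) then v else + 0) (∑≤-indicator i′ k (λ i → c * F j i))) ⟩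
    ∑≤ n (λ j → if does (j′ ℕ.≟ j) then (if does (i′ ≤? k) then c * F j i′ else + 0) else + 0)
      ≡⟨ ∑≤-indicator j′ n (λ j → if does (i′ ≤? k) then c * F j i′ else + 0) ⟩
    (if does (j′ ≤? n) then (if does (i′ ≤? k) then c * F j′ i′ else + 0) else + 0)
      ≡⟨ merge (does (j′ ≤? n)) ⟩
    mulTerm (c , i′ , j′) f n k ∎)
    where
    open ≡-Reasoning
    F : ℕ → ℕ → ℤ
    F j i = f (n ∸ j) (k ∸ i)
    split : ∀ b₁ b₂ x → (if b₁ ∧ b₂ then c else + 0) * x ≡ (if b₂ then (if b₁ then c * x else + 0) else + 0)
    split true  true  x = refl
    split true  false x = ℤ.*-zeroˡ x
    split false true  x = ℤ.*-zeroˡ x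
    split false false x = ℤ.*-zeroˡ x
    merge : ∀ b → (if b then (if does (i′ ≤? k) then c * F j′ i′ else + 0) else + 0)
                ≡ (if b ∧ does (i′ ≤? k) then c * F j′ i′ else + 0)
    merge true  = refl
    merge false = refl

  ∑≤-zero : ∀ n → ∑≤ n (λ _ → + 0) ≡ + 0
  ∑≤-zero zero    = refl
  ∑≤-zero (suc n) = cong (_+ + 0) (∑≤-zero n)

  convolution-+ : ∀ (a b : ℕ → ℕ → ℤ) f n k →
    convolution a f n k + convolution b f n k ≡ convolution (λ j i → a j i + b j i) f n k
  convolution-+ a b f n k = sym (trans
    (∑≤-cong n λ j → trans (∑≤-cong k λ i → ℤ.*-distribʳ-+ (f (n ∸ j) (k ∸ i)) (a j i) (b j i))
                           (∑≤-+ k (λ i → a j i * f (n ∸ j) (k ∸ i)) (λ i → b j i * f (n ∸ j) (k ∸ i))))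
    (∑≤-+ n _ _))

  mulPoly-convolution : ∀ P f n k → mulPoly P f n k ≡ convolution (coeffPoly P) f n k
  mulPoly-convolution []      f n k =
    sym (trans (∑≤-cong n λ j → trans (∑≤-cong k λ i → ℤ.*-zeroˡ (f (n ∸ j) (k ∸ i))) (∑≤-zero k)) (∑≤-zero n))
  mulPoly-convolution (t ∷ P) f n k =
    trans (cong₂ _+_ (mulTerm-convolution t f n k) (mulPoly-convolution P f n k))
          (convolution-+ (termCoeff t) (coeffPoly P) f n k)

  mulPoly-coeffPoly : ∀ P Q → (∀ n k → coeffPoly P n k ≡ coeffPoly Q n k) → ∀ f n k → mulPoly P f n k ≡ mulPoly Q f n k
  mulPoly-coeffPoly P Q same f n k = begin
    mulPoly P f n k                    ≡⟨ mulPoly-convolution P f n k ⟩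
    convolution (coeffPoly P) f n k    ≡⟨ ∑≤-cong n (λ j → ∑≤-cong k λ i → cong (_* f (n ∸ j) (k ∸ i)) (same j i)) ⟩
    convolution (coeffPoly Q) f n k    ≡⟨ mulPoly-convolution Q f n k ⟨
    mulPoly Q f n k                    ∎
    where open ≡-Reasoning

  Bounded : ℕ → Poly → Set
  Bounded B = All λ (_ , i , j) → i ℕ.< B × j ℕ.< B

  coeffPoly-beyond : ∀ {B P n k} → Bounded B P → B ℕ.≤ n ⊎ B ℕ.≤ k → coeffPoly P n k ≡ + 0
  coeffPoly-beyond         []                       _       = refl
  coeffPoly-beyond {B} {(c , i , j) ∷ _} {n} {k} ((i<B , j<B) ∷ bounded) far =
    trans (cong₂ _+_ (absent (i ℕ.≟ k) (j ℕ.≟ n) far) (coeffPoly-beyond bounded far)) refl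
    where
    absent : (i≡k? : Dec (i ≡ k)) (j≡n? : Dec (j ≡ n)) → B ℕ.≤ n ⊎ B ℕ.≤ k →
             (if does i≡k? ∧ does j≡n? then c else + 0) ≡ + 0
    absent (yes refl) (yes refl) (inj₁ B≤n) = ⊥-elim (ℕ.<-irrefl refl (ℕ.<-≤-trans j<B B≤n))
    absent (yes refl) (yes refl) (inj₂ B≤k) = ⊥-elim (ℕ.<-irrefl refl (ℕ.<-≤-trans i<B B≤k))
    absent (yes _)    (no _)     _          = refl
    absent (no _)     _          _          = refl

  coeffPoly-agree : ∀ B {P Q} → Bounded B P → Bounded B Q →
    (∀ (n k : Fin B) → coeffPoly P (toℕ n) (toℕ k) ≡ coeffPoly Q (toℕ n) (toℕ k)) →
    ∀ n k → coeffPoly P n k ≡ coeffPoly Q n k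
  coeffPoly-agree B {P} {Q} bP bQ agree n k with n ℕ.<? B | k ℕ.<? B
  ... | yes n<B | yes k<B =
    subst₂ (λ n′ k′ → coeffPoly P n′ k′ ≡ coeffPoly Q n′ k′) (Fin.toℕ-fromℕ< n<B) (Fin.toℕ-fromℕ< k<B)
           (agree (fromℕ< n<B) (fromℕ< k<B))
  ... | no n≮B | _      = trans (coeffPoly-beyond bP far) (sym (coeffPoly-beyond bQ far))
    where
    far : B ℕ.≤ n ⊎ B ℕ.≤ k
    far = inj₁ (ℕ.≮⇒≥ n≮B)
  ... | yes _  | no k≮B = trans (coeffPoly-beyond bP far) (sym (coeffPoly-beyond bQ far))
    where
    far : B ℕ.≤ n ⊎ B ℕ.≤ k
    far = inj₂ (ℕ.≮⇒≥ k≮B)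

  unit : Series
  unit zero zero = + 1
  unit _    _    = + 0

  coeffPoly-unit : ∀ P n k → coeffPoly P n k ≡ mulPoly P unit n k
  coeffPoly-unit []                n k = refl
  coeffPoly-unit ((c , i , j) ∷ P) n k = cong₂ _+_ (term j n) (coeffPoly-unit P n k)
    where
    ∧-false : ∀ b {x : ℤ} → (if b ∧ false then x else + 0) ≡ + 0
    ∧-false true  = refl
    ∧-false false = refl
    at-zero : ∀ i k → (if does (i ℕ.≟ k) ∧ true then c else + 0) ≡ mulTerm (c , i , 0) unit 0 k
    at-zero zero    zero    = sym (ℤ.*-identityʳ c)
    at-zero zero    (suc k) = sym (ℤ.*-zeroʳ c)
    at-zero (suc i) zero    = refl
    at-zero (suc i) (suc k) rewrite ≤?-suc i k = at-zero i k
    term : ∀ j n → (if does (i ℕ.≟ k) ∧ does (j ℕ.≟ n) then c else + 0) ≡ mulTerm (c , i , j) unit n k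
    term zero    zero    = at-zero i k
    term zero    (suc n) = trans (∧-false (does (i ℕ.≟ k))) (sym (mulTerm-zero (c , i , 0) (suc n) k))
    term (suc j) zero    = ∧-false (does (i ℕ.≟ k))
    term (suc j) (suc n) rewrite ≤?-suc j n = term j n

  apply : Vec Poly m → Vec Series m → Series
  apply []       []       n k = + 0
  apply (P ∷ Ps) (f ∷ fs) n k = mulPoly P f n k + apply Ps fs n k

  apply-empty : ∀ (fs : Vec Series m) n k → apply (replicate m []) fs n k ≡ + 0
  apply-empty []       n k = refl
  apply-empty (f ∷ fs) n k = trans (ℤ.+-identityˡ _) (apply-empty fs n k)

  _⊕_ : Vec Poly m → Vec Poly m → Vec Poly m
  _⊕_ = zipWith _++_

  apply-⊕ : ∀ (Ps Qs : Vec Poly m) fs n k → apply (Ps ⊕ Qs) fs n k ≡ apply Ps fs n k + apply Qs fs n k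
  apply-⊕ []       []       []       n k = refl
  apply-⊕ (P ∷ Ps) (Q ∷ Qs) (f ∷ fs) n k =
    trans (cong₂ _+_ (mulPoly-++ P Q f n k) (apply-⊕ Ps Qs fs n k))
          (interchange (mulPoly P f n k) (mulPoly Q f n k) (apply Ps fs n k) (apply Qs fs n k))

  scale : Poly → Vec Poly m → Vec Poly m
  scale c = Vec.map (c ⊗_)

  apply-scale : ∀ c (Ps : Vec Poly m) fs n k → mulPoly c (apply Ps fs) n k ≡ apply (scale c Ps) fs n k
  apply-scale c []       []       n k = mulPoly-zero c (λ _ _ → refl) n k
  apply-scale c (P ∷ Ps) (f ∷ fs) n k =
    trans (mulPoly-+ c (mulPoly P f) (apply Ps fs) n k)
          (cong₂ _+_ (mulPoly-⊗ c P f n k) (apply-scale c Ps fs n k))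

  combine : Vec Poly r → Vec (Vec Poly m) r → Vec Poly m
  combine         []       []       = replicate _ []
  combine {m = m} (c ∷ cs) (E ∷ Es) = scale c E ⊕ combine cs Es

  apply-combine : ∀ (cs : Vec Poly r) (Es : Vec (Vec Poly m) r) fs →
    (∀ i n k → apply (lookup Es i) fs n k ≡ + 0) → ∀ n k → apply (combine cs Es) fs n k ≡ + 0
  apply-combine         []       []       fs _        n k = apply-empty fs n k
  apply-combine {m = m} (c ∷ cs) (E ∷ Es) fs relations n k =
    trans (apply-⊕ (scale c E) (combine cs Es) fs n k)
          (cong₂ _+_ (trans (sym (apply-scale c E fs n k)) (mulPoly-zero c (relations zero) n k))
                     (apply-combine cs Es fs (relations ∘ suc) n k))


  apply-coeffPoly : ∀ (Ps Qs : Vec Poly m) → (∀ s n k → coeffPoly (lookup Ps s) n k ≡ coeffPoly (lookup Qs s) n k) →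
    ∀ fs n k → apply Ps fs n k ≡ apply Qs fs n k
  apply-coeffPoly []       []       _    []       n k = refl
  apply-coeffPoly (P ∷ Ps) (Q ∷ Qs) same (f ∷ fs) n k =
    cong₂ _+_ (mulPoly-coeffPoly P Q (same zero) f n k) (apply-coeffPoly Ps Qs (same ∘ suc) fs n k)

  allBounded? : ∀ B (Ps : Vec Poly m) → Dec (∀ s → Bounded B (lookup Ps s))
  allBounded? B Ps = Fin.all? λ s → All.all? (λ (_ , i , j) → (i <? B) ×-dec (j <? B)) (lookup Ps s)

  AgreeBelow : ℕ → Vec Poly m → Vec Poly m → Set
  AgreeBelow B Ps Qs = ∀ s (n k : Fin B) → coeffPoly (lookup Ps s) (toℕ n) (toℕ k) ≡ coeffPoly (lookup Qs s) (toℕ n) (toℕ k)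

  agreeBelow? : ∀ B (Ps Qs : Vec Poly m) → Dec (AgreeBelow B Ps Qs)
  agreeBelow? B Ps Qs = Fin.all? λ s → Fin.all? λ n → Fin.all? λ k →
    coeffPoly (lookup Ps s) (toℕ n) (toℕ k) ℤ.≟ coeffPoly (lookup Qs s) (toℕ n) (toℕ k)

  -- For closed polynomials the implicit arguments reduce to ⊤, so the check is done by evaluation.
  apply-byComputation : ∀ B (Ps Qs : Vec Poly m) →
    {True (allBounded? B Ps)} → {True (allBounded? B Qs)} → {True (agreeBelow? B Ps Qs)} →
    ∀ fs n k → apply Ps fs n k ≡ apply Qs fs n k
  apply-byComputation B Ps Qs {bP} {bQ} {agree} = apply-coeffPoly Ps Qs λ s →
    coeffPoly-agree B (toWitness bP s) (toWitness bQ s) (toWitness agree s)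

  sumSeries : Vec Series m → Series
  sumSeries []       n k = + 0
  sumSeries (f ∷ fs) n k = f n k + sumSeries fs n k

  apply-replicate : ∀ Q (fs : Vec Series m) n k → apply (replicate m Q) fs n k ≡ mulPoly Q (sumSeries fs) n k
  apply-replicate Q []       n k = sym (mulPoly-zero Q (λ _ _ → refl) n k)
  apply-replicate Q (f ∷ fs) n k =
    trans (cong (λ x → mulPoly Q f n k + x) (apply-replicate Q fs n k)) (sym (mulPoly-+ Q f (sumSeries fs) n k))

  series : Shape → Series
  series c n k = + count c n k

  P H V V⁺ : Series
  P  = series pyramidal
  H  = series pyramidal⁺
  V  = series elevated
  V⁺ = series elevated⁺

  unknowns : Vec Series 5
  unknowns = unit ∷ P ∷ H ∷ V ∷ V⁺ ∷ []

  -z 1-z 1-z-tz : Poly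
  -z     = (- + 1 , 0 , 1) ∷ []
  1-z    = (+ 1 , 0 , 0) ∷ (- + 1 , 0 , 1) ∷ []
  1-z-tz = (+ 1 , 0 , 0) ∷ (- + 1 , 0 , 1) ∷ (- + 1 , 1 , 1) ∷ []

  tShift : Series → Series
  tShift f n zero    = + 0
  tShift f n (suc k) = f n k

  mulPoly--z : ∀ f m k → mulPoly -z f (suc m) k ≡ - f m k
  mulPoly--z f m k = identity (f m k)
    where
    identity : ∀ x → - + 1 * x + + 0 ≡ - x
    identity = solve-∀

  mulPoly-1-z : ∀ f m k → mulPoly 1-z f (suc m) k ≡ f (suc m) k - f m k
  mulPoly-1-z f m k = identity (f (suc m) k) (f m k)
    where
    identity : ∀ x y → + 1 * x + (- + 1 * y + + 0) ≡ x - y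
    identity = solve-∀

  mulPoly-1-z-tz : ∀ f m k → mulPoly 1-z-tz f (suc m) k ≡ f (suc m) k - f m k - tShift f m k
  mulPoly-1-z-tz f m zero    = identity (f (suc m) 0) (f m 0)
    where
    identity : ∀ x y → + 1 * x + (- + 1 * y + (+ 0 + + 0)) ≡ x - y - + 0
    identity = solve-∀
  mulPoly-1-z-tz f m (suc k) = identity (f (suc m) (suc k)) (f m (suc k)) (f m k)
    where
    identity : ∀ x y z → + 1 * x + (- + 1 * y + (- + 1 * z + + 0)) ≡ x - y - z
    identity = solve-∀

  below-tShift : ∀ c m k → + below (count c m) k ≡ tShift (series c) m k
  below-tShift c m zero    = refl
  below-tShift c m (suc k) = refl

  -- Each relation is a recurrence of count read as an identity of generating functions in the
  -- unknowns; e.g. the first says (1 - z - tz)·H = z·(P + V + V⁺).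
  pyramidal⁺-relation : ∀ n k → apply ([] ∷ -z ∷ 1-z-tz ∷ -z ∷ -z ∷ []) unknowns n k ≡ + 0
  pyramidal⁺-relation zero    k = refl
  pyramidal⁺-relation (suc m) k = begin
    + 0 + (mulPoly -z P (suc m) k + (mulPoly 1-z-tz H (suc m) k + (mulPoly -z V (suc m) k + (mulPoly -z V⁺ (suc m) k + + 0))))
      ≡⟨ cong (λ x → + 0 + x) (cong₂ _+_ (mulPoly--z P m k) (cong₂ _+_ (mulPoly-1-z-tz H m k)
                         (cong₂ _+_ (mulPoly--z V m k) (cong (_+ + 0) (mulPoly--z V⁺ m k))))) ⟩
    + 0 + (- P m k + ((H (suc m) k - H m k - tShift H m k) + (- V m k + (- V⁺ m k + + 0))))
      ≡⟨ cong (λ t → + 0 + (- P m k + (((P m k + (V m k + V⁺ m k) + t) + H m k - H m k - tShift H m k)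
                                       + (- V m k + (- V⁺ m k + + 0)))))
              (below-tShift pyramidal⁺ m k) ⟩
    + 0 + (- P m k + ((P m k + (V m k + V⁺ m k) + tShift H m k + H m k - H m k - tShift H m k)
                     + (- V m k + (- V⁺ m k + + 0))))
      ≡⟨ identity (P m k) (V m k) (V⁺ m k) (tShift H m k) (H m k) ⟩
    + 0 ∎
    where
    open ≡-Reasoning
    identity : ∀ p v w t h → + 0 + (- p + ((p + (v + w) + t + h - h - t) + (- v + (- w + + 0)))) ≡ + 0
    identity = solve-∀

  elevated-relation : ∀ n k → apply ([] ∷ [] ∷ -z ∷ 1-z ∷ -z ∷ []) unknowns n k ≡ + 0
  elevated-relation zero    k = refl
  elevated-relation (suc m) k = begin
    + 0 + (+ 0 + (mulPoly -z H (suc m) k + (mulPoly 1-z V (suc m) k + (mulPoly -z V⁺ (suc m) k + + 0))))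
      ≡⟨ cong (λ x → + 0 + (+ 0 + x)) (cong₂ _+_ (mulPoly--z H m k)
                (cong₂ _+_ (mulPoly-1-z V m k) (cong (_+ + 0) (mulPoly--z V⁺ m k)))) ⟩
    + 0 + (+ 0 + (- H m k + ((H m k + (V m k + V⁺ m k) - V m k) + (- V⁺ m k + + 0))))
      ≡⟨ identity (H m k) (V m k) (V⁺ m k) ⟩
    + 0 ∎
    where
    open ≡-Reasoning
    identity : ∀ h v w → + 0 + (+ 0 + (- h + ((h + (v + w) - v) + (- w + + 0)))) ≡ + 0
    identity = solve-∀

  elevated⁺-relation : ∀ n k → apply ([] ∷ [] ∷ [] ∷ -z ∷ 1-z-tz ∷ []) unknowns n k ≡ + 0
  elevated⁺-relation zero    k = refl
  elevated⁺-relation (suc m) k = begin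
    + 0 + (+ 0 + (+ 0 + (mulPoly -z V (suc m) k + (mulPoly 1-z-tz V⁺ (suc m) k + + 0))))
      ≡⟨ cong (λ x → + 0 + (+ 0 + (+ 0 + x))) (cong₂ _+_ (mulPoly--z V m k) (cong (_+ + 0) (mulPoly-1-z-tz V⁺ m k))) ⟩
    + 0 + (+ 0 + (+ 0 + (- V m k + ((V m k + + below (count elevated⁺ m) k + V⁺ m k - V⁺ m k - tShift V⁺ m k) + + 0))))
      ≡⟨ cong (λ t → + 0 + (+ 0 + (+ 0 + (- V m k + ((V m k + t + V⁺ m k - V⁺ m k - tShift V⁺ m k) + + 0)))))
              (below-tShift elevated⁺ m k) ⟩
    + 0 + (+ 0 + (+ 0 + (- V m k + ((V m k + tShift V⁺ m k + V⁺ m k - V⁺ m k - tShift V⁺ m k) + + 0))))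
      ≡⟨ identity (V m k) (tShift V⁺ m k) (V⁺ m k) ⟩
    + 0 ∎
    where
    open ≡-Reasoning
    identity : ∀ v t w → + 0 + (+ 0 + (+ 0 + (- v + ((v + t + w - w - t) + + 0)))) ≡ + 0
    identity = solve-∀

  pyramidal-relation : ∀ n k → apply (-z ∷ 1-z ∷ [] ∷ [] ∷ [] ∷ []) unknowns n k ≡ + 0
  pyramidal-relation zero    k = refl
  pyramidal-relation (suc m) k = begin
    mulPoly -z unit (suc m) k + (mulPoly 1-z P (suc m) k + (+ 0 + (+ 0 + (+ 0 + + 0))))
      ≡⟨ cong₂ _+_ (mulPoly--z unit m k) (cong (_+ (+ 0 + (+ 0 + (+ 0 + + 0)))) (mulPoly-1-z P m k)) ⟩
    - unit m k + ((P (suc m) k - P m k) + (+ 0 + (+ 0 + (+ 0 + + 0))))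
      ≡⟨ cong (λ d → - unit m k + (d + (+ 0 + (+ 0 + (+ 0 + + 0))))) (pyramid-step m k) ⟩
    - unit m k + (unit m k + (+ 0 + (+ 0 + (+ 0 + + 0))))
      ≡⟨ identity (unit m k) ⟩
    + 0 ∎
    where
    open ≡-Reasoning
    pyramid-step : ∀ m k → P (suc m) k - P m k ≡ unit m k
    pyramid-step zero    zero    = refl
    pyramid-step zero    (suc k) = refl
    pyramid-step (suc m) zero    = refl
    pyramid-step (suc m) (suc k) = refl
    identity : ∀ u → - u + (u + (+ 0 + (+ 0 + (+ 0 + + 0)))) ≡ + 0
    identity = solve-∀

  relations : Vec (Vec Poly 5) 4
  relations = ([] ∷ -z  ∷ 1-z-tz ∷ -z  ∷ -z     ∷ [])
            ∷ ([] ∷ []  ∷ -z     ∷ 1-z ∷ -z     ∷ [])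
            ∷ ([] ∷ []  ∷ []     ∷ -z  ∷ 1-z-tz ∷ [])
            ∷ (-z ∷ 1-z ∷ []     ∷ []  ∷ []     ∷ [])
            ∷ []

  relations-hold : ∀ i n k → apply (lookup relations i) unknowns n k ≡ + 0
  relations-hold zero                   = pyramidal⁺-relation
  relations-hold (suc zero)             = elevated-relation
  relations-hold (suc (suc zero))       = elevated⁺-relation
  relations-hold (suc (suc (suc zero))) = pyramidal-relation

  -- Cofactors found by solving the linear system: Σᵢ cofactorᵢ · relationᵢ = target below.
  cofactors : Vec Poly 4
  cofactors = ((+ 1 , 0 , 0) ∷ (- + 2 , 0 , 1) ∷ (- + 1 , 1 , 1) ∷ (+ 1 , 0 , 2) ∷ (+ 1 , 1 , 2) ∷ [])
            ∷ ((+ 1 , 0 , 0) ∷ (- + 1 , 0 , 1) ∷ (- + 2 , 1 , 1) ∷ (+ 2 , 1 , 2) ∷ (+ 1 , 2 , 2) ∷ (- + 1 , 2 , 3) ∷ [])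
            ∷ ((+ 1 , 0 , 0) ∷ (- + 1 , 0 , 1) ∷ (- + 1 , 1 , 1) ∷ (+ 1 , 1 , 2) ∷ [])
            ∷ ((+ 1 , 0 , 0) ∷ (- + 2 , 0 , 1) ∷ (- + 2 , 1 , 1) ∷ (+ 3 , 1 , 2) ∷ (+ 1 , 2 , 2) ∷ (- + 1 , 2 , 3) ∷ [])
            ∷ []

  denominator : Poly
  denominator = denom₁ ⊗ denom₂

  target : Vec Poly 5
  target = (denominator ++ negate numer) ∷ replicate 4 denominator

  target-vanishes : ∀ n k → apply target unknowns n k ≡ + 0
  target-vanishes n k =
    trans (sym (apply-byComputation 5 (combine cofactors relations) target unknowns n k))
          (apply-combine cofactors relations unknowns relations-hold n k)

  wordCount-series : ∀ n k → + wordCount n k ≡ sumSeries unknowns n k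
  wordCount-series n k =
    cong₂ _+_ (empty≡unit n k) (cong (λ x → P n k + (H n k + (V n k + x))) (sym (ℤ.+-identityʳ (V⁺ n k))))
    where
    empty≡unit : ∀ n k → + count empty n k ≡ unit n k
    empty≡unit zero    zero    = refl
    empty≡unit zero    (suc k) = refl
    empty≡unit (suc n) k       = refl

  target-split : ∀ n k → mulPoly denominator (sumSeries unknowns) n k - mulPoly numer unit n k ≡ apply target unknowns n k
  target-split n k = begin
    L (sumSeries unknowns) n k - mulPoly numer unit n k
      ≡⟨ cong (_- mulPoly numer unit n k) (mulPoly-+ denominator unit (sumSeries tail) n k) ⟩
    L unit n k + L (sumSeries tail) n k - mulPoly numer unit n k
      ≡⟨ rearrange (L unit n k) _ _ ⟩
    L unit n k + - mulPoly numer unit n k + L (sumSeries tail) n k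
      ≡⟨ cong₂ _+_ (cong (λ x → L unit n k + x) (sym (mulPoly-negate numer unit n k)))
                   (sym (apply-replicate denominator tail n k)) ⟩
    L unit n k + mulPoly (negate numer) unit n k + apply (replicate 4 denominator) tail n k
      ≡⟨ cong (_+ apply (replicate 4 denominator) tail n k) (sym (mulPoly-++ denominator (negate numer) unit n k)) ⟩
    apply target unknowns n k ∎
    where
    open ≡-Reasoning
    L : Series → Series
    L = mulPoly denominator
    tail : Vec Series 4
    tail = P ∷ H ∷ V ∷ V⁺ ∷ []
    rearrange : ∀ a b c → a + b - c ≡ a + - c + b
    rearrange = solve-∀

  generatingFunction : ∀ n k →
    mulPoly denom₁ (mulPoly denom₂ (λ n′ k′ → + wordCount n′ k′)) n k ≡ coeffPoly numer n k
  generatingFunction n k = begin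
    mulPoly denom₁ (mulPoly denom₂ A) n k          ≡⟨ mulPoly-⊗ denom₁ denom₂ A n k ⟩
    mulPoly denominator A n k                      ≡⟨ mulPoly-cong denominator wordCount-series n k ⟩
    mulPoly denominator (sumSeries unknowns) n k   ≡⟨ ℤ.i-j≡0⇒i≡j _ _ (trans (target-split n k) (target-vanishes n k)) ⟩
    mulPoly numer unit n k                         ≡⟨ coeffPoly-unit numer n k ⟨
    coeffPoly numer n k                            ∎
    where
    open ≡-Reasoning
    A : Series
    A n′ k′ = + wordCount n′ k′

open import Data.Integer using (+_)

mainTheorem14 : Σ (ℕ → ℕ → ℕ) λ a →
    ((n k : ℕ) → HasCard (Counted n k) (a n k)) ×
    ((n k : ℕ) → mulPoly denom₁ (mulPoly denom₂ (λ n′ k′ → + (a n′ k′))) n k ≡ coeffPoly numer n k)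
mainTheorem14 = Counting.wordCount , Counting.enumerateCounted , Algebra.generatingFunction
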